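{- Let $A\subseteq F_I(\Gamma^m)$ be a basic Presburger set, and let $J,H$ be subsets of $\{1,\dots,m\}$ such that $F_J(A)$ and $F_H(A)$ are non-empty. Then: (1) $F_J(A)=\pi_J(A)$. (2) If $H\subseteq J$ then $F_H(A)=F_H(F_J(A))$. (3) $F_H(A)\subseteq\overline{F_J(A)}$ if and only if $H\subseteq J$. In particular the faces of $A$ are linearly ordered by specialisation if and only if their supports are linearly ordered by inclusion. (4) $F_{H\cap J}(A)$ is non-empty.
   Context: $\mathcal{Z}$ is a $\mathbb{Z}$-group (linearly ordered abelian group with a smallest positive element such that $\mathcal{Z}/n\mathcal{Z}$ has $n$ elements for all $n\ge1$, e.g. $\mathbb Z$), $\mathcal Q\supseteq\mathbb Q$ its divisible hull, $\Gamma=\mathcal Z\cup\{+\infty\}$, $\Omega=\mathcal Q\cup\{+\infty\}$, with $a<+\infty$ and $a+(+\infty)=+\infty$. $\Omega$ has the topology generated by open intervals and sets $]a,+\infty]$ ($a\in\mathcal Q$); $\Omega^m$ the product topology; $\overline S$ is closure in $\Omega^m$. For $a\in\Omega^m$, $\mathrm{Supp}\,a=\{i:a_i\ne+\infty\}$; $F_I(\Gamma^m)=\{a\in\Gamma^m:\mathrm{Supp}\,a=I\}$; $F_I(S)=\{a\in\overline S:\mathrm{Supp}\,a=I\}$, a face of $S$ when nonempty; specialisation order on faces: $B\le C$ iff $B\subseteq\overline C$. $\pi_J(a)_i=a_i$ for $i\in J$ and $+\infty$ otherwise. For $a,b\in\mathcal Z$, $a\equiv b\,[n]$ means $a-b\in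 n\mathcal Z$. A basic Presburger set $A\subseteq F_I(\Gamma^m)$ is the set of $x\in F_I(\Gamma^m)$ satisfying finitely many conditions $\varphi_l(x)\ge\gamma_l$ and $\psi_l(x)\equiv\rho_l\,[n_l]$, where $\varphi_l,\psi_l:F_I(\Gamma^m)\to\mathcal Z$ are integrally linear maps $x\mapsto\sum_{i\in I}c_ix_i$ ($c_i\in\mathbb Z$), $\gamma_l\in\mathcal Z$, and $n_l\ge1$, $0\le\rho_l<n_l$ are integers. -}

module Defs where

open import Level using (Level) renaming (suc to lsuc)
open import Data.Nat using (ℕ; zero; suc)
open import Data.Integer using (ℤ; +_; -[1+_])
open import Data.Bool using (Bool; true; false)
open import Data.Maybe using (Maybe; just; nothing)
open import Data.Fin using (Fin; zero; suc; toℕ)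
open import Data.Fin.Subset using (Subset; _∈_)
open import Data.Vec using (lookup)
open import Data.List using (List)
open import Data.List.Relation.Unary.All using (All)
open import Data.Product using (Σ; ∃; _×_; _,_)
open import Data.Sum using (_⊎_)
open import Relation.Binary.PropositionalEquality using (_≡_)
open import Relation.Nullary using (¬_)

scaleℕ : ∀ {c} {A : Set c} → (A → A → A) → A → ℕ → A → A
scaleℕ _+_ 0# zero    x = 0#
scaleℕ _+_ 0# (suc n) x = x + scaleℕ _+_ 0# n x

CongMod : ∀ {c} {A : Set c} → (A → A → A) → A → ℕ → A → A → Set c
CongMod _+_ 0# n x y = ∃ λ z → x ≡ y + scaleℕ _+_ 0# n z

-- A Z-group: linearly ordered abelian group with a smallest positive
-- element 1# such that Z/nZ has exactly n elements for every n ≥ 1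
-- (there is a family of n representatives, every element is congruent
-- to one of them, and distinct representatives are incongruent).
record ZGroup (c : Level) : Set (lsuc c) where
  infixl 6 _+_
  infix 4 _<_
  field
    Carrier : Set c
    _+_ : Carrier → Carrier → Carrier
    0# : Carrier
    -_ : Carrier → Carrier
    _<_ : Carrier → Carrier → Set c
    1# : Carrier
    +-assoc : ∀ x y z → (x + y) + z ≡ x + (y + z)
    +-comm : ∀ x y → x + y ≡ y + x
    +-identityʳ : ∀ x → x + 0# ≡ x
    +-inverseʳ : ∀ x → x + (- x) ≡ 0#
    <-irrefl : ∀ x → ¬ (x < x)
    <-trans : ∀ {x y z} → x < y → y < z → x < z
    <-trichotomy : ∀ x y → x < y ⊎ x ≡ y ⊎ y < x
    <-+-compat : ∀ x y z → x < y → x + z < y + z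
    0<1 : 0# < 1#
    1-least : ∀ x → 0# < x → 1# ≡ x ⊎ 1# < x
    Z/nZ-card : ∀ n → Σ (Fin (suc n) → Carrier) λ rep →
      (∀ x → ∃ λ r → CongMod _+_ 0# (suc n) x (rep r)) ×
      (∀ r r' → CongMod _+_ 0# (suc n) (rep r) (rep r') → r ≡ r')

module ZG {c : Level} (𝒵 : ZGroup c) where
  open ZGroup 𝒵

  _≤_ : Carrier → Carrier → Set c
  x ≤ y = x < y ⊎ x ≡ y

  _×ₙ_ : ℕ → Carrier → Carrier
  n ×ₙ x = scaleℕ _+_ 0# n x

  _×ℤ_ : ℤ → Carrier → Carrier
  (+ n) ×ℤ x = n ×ₙ x
  -[1+ n ] ×ℤ x = - (suc n ×ₙ x)

  _≡[_]_ : Carrier → ℕ → Carrier → Set c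
  x ≡[ n ] y = CongMod _+_ 0# n x y

  sumFin : ∀ {m} → (Fin m → Carrier) → Carrier
  sumFin {zero} f = 0#
  sumFin {suc m} f = f zero + sumFin (λ i → f (suc i))

  -- divisible hull 𝒬: formal fractions num / (suc den-1)
  record Q : Set c where
    constructor _/1+_
    field
      num : Carrier
      den-1 : ℕ
    den : ℕ
    den = suc den-1
  open Q

  _<Q_ : Q → Q → Set c
  p <Q q = den q ×ₙ num p < den p ×ₙ num q

  _≈Q_ : Q → Q → Set c
  p ≈Q q = den q ×ₙ num p ≡ den p ×ₙ num q

  ιQ : Carrier → Q
  ιQ z = z /1+ 0

  data Ext (A : Set c) : Set c where
    fin : A → Ext A
    ∞ : Ext A

  data IsFin {A : Set c} : Ext A → Set c where
    isFin : ∀ a → IsFin (fin a)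

  Γ : Set c
  Γ = Ext Carrier

  Ω : Set c
  Ω = Ext Q

  data _≈Ω_ : Ω → Ω → Set c where
    fin≈ : ∀ {p q} → p ≈Q q → fin p ≈Ω fin q
    ∞≈ : ∞ ≈Ω ∞

  ιΓ : Γ → Ω
  ιΓ (fin z) = fin (ιQ z)
  ιΓ ∞ = ∞

  HasSupp : ∀ {A : Set c} {m} → Subset m → (Fin m → Ext A) → Set c
  HasSupp J a = ∀ i → (i ∈ J → IsFin (a i)) × (IsFin (a i) → i ∈ J)

  SetΓ : ℕ → Set (lsuc c)
  SetΓ m = (Fin m → Γ) → Set c

  SetΩ : ℕ → Set (lsuc c)
  SetΩ m = (Fin m → Ω) → Set c

  _⊆ₛ_ : ∀ {m} → SetΩ m → SetΩ m → Set c
  S ⊆ₛ T = ∀ a → S a → T a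

  _≐_ : ∀ {m} → SetΩ m → SetΩ m → Set c
  S ≐ T = ∀ a → (S a → T a) × (T a → S a)

  Nonempty : ∀ {m} → SetΩ m → Set c
  Nonempty S = ∃ S

  liftΓ : ∀ {m} → SetΓ m → SetΩ m
  liftΓ A a = ∃ λ x → A x × (∀ i → a i ≈Ω ιΓ (x i))

  -- generators of the topology of Ω:  ]lo,hi[  (hi = just b)  or  ]lo,+∞]  (hi = nothing)
  record BOpen : Set c where
    constructor ⟨_,_⟩
    field
      lo : Q
      hi : Maybe Q

  data Above (l : Q) : Ω → Set c where
    above-fin : ∀ {q} → l <Q q → Above l (fin q)
    above-∞ : Above l ∞

  data Below : Maybe Q → Ω → Set c where
    below-none : ∀ {x} → Below nothing x
    below-fin : ∀ {q u} → q <Q u → Below (just u) (fin q)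

  _∈B_ : Ω → BOpen → Set c
  x ∈B U = Above (BOpen.lo U) x × Below (BOpen.hi U) x

  cl : ∀ {m} → SetΩ m → SetΩ m
  cl S a = ∀ (U : Fin _ → BOpen) → (∀ i → a i ∈B U i) →
           ∃ λ s → S s × (∀ i → s i ∈B U i)

  F : ∀ {m} → Subset m → SetΩ m → SetΩ m
  F J S a = cl S a × HasSupp J a

  π : ∀ {m} → Subset m → (Fin m → Γ) → (Fin m → Γ)
  π J x i with lookup J i
  ... | true = x i
  ... | false = ∞

  πset : ∀ {m} → Subset m → SetΓ m → SetΩ m
  πset J A a = ∃ λ x → A x × (∀ i → a i ≈Ω ιΓ (π J x i))

  record Ineq (m : ℕ) : Set c where
    field
      coeff : Fin m → ℤ
      bound : Carrier

  record CongCond (m : ℕ) : Set c where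
    field
      coeff : Fin m → ℤ
      modulus-1 : ℕ
      residue : Fin (suc modulus-1)

  record BasicPresburger (m : ℕ) : Set c where
    field
      I : Subset m
      ineqs : List (Ineq m)
      congs : List (CongCond m)

  term : ℤ → Γ → Carrier
  term k (fin z) = k ×ℤ z
  term k ∞ = 0#

  -- integrally linear map x ↦ Σ c_i x_i (on F_I(Γ^m) the finite coordinates are exactly i ∈ I)
  lin : ∀ {m} → (Fin m → ℤ) → (Fin m → Γ) → Carrier
  lin cf x = sumFin (λ i → term (cf i) (x i))

  ⟦_⟧ : ∀ {m} → BasicPresburger m → SetΓ m
  ⟦ P ⟧ x =
    HasSupp (BasicPresburger.I P) x ×
    All (λ φ → Ineq.bound φ ≤ lin (Ineq.coeff φ) x) (BasicPresburger.ineqs P) ×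
    All (λ ψ → lin (CongCond.coeff ψ) x ≡[ suc (CongCond.modulus-1 ψ) ]
                 (toℕ (CongCond.residue ψ) ×ₙ 1#)) (BasicPresburger.congs P)

-- A point a with support K lies in the closure of A exactly when A contains points that agree
-- with a on K while their coordinates in I ∖ K exceed any bound B.  Read as a linear system in
-- the parameter B, this is solvable for every B, so Fourier–Motzkin elimination produces an
-- integer recession direction d of A with d = 0 on K and d ≥ 1 on I ∖ K.  Shifting any x ∈ A
-- by a large multiple of d that is divisible by every modulus stays in A, keeps the coordinates
-- in K and pushes those in I ∖ K towards +∞; hence π_K(x) lies in the closure of π_J(A) for
-- every J ⊇ K.  With J = {1, …, m} this gives F_K(A) = π_K(A), and with J ⊇ H it gives
-- F_H(A) ⊆ closure(F_J(A)).  Conversely a neighbourhood of a point of F_H(A) that bounds its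
-- finite coordinates forces H ⊆ J, and the sum of the directions for H and J is a direction
-- for H ∩ J.

module Submission where

open import Defs
open import Level using (Level)
open import Data.Nat as ℕ using (ℕ; zero; suc; NonZero)
import Data.Nat.Properties as ℕP
open import Data.Nat.Divisibility using (_∣_; divides; ∣-trans; m∣m*n; n∣m*n)
open import Data.Nat.ListAction using (product)
open import Data.Integer as ℤ using (ℤ; -[1+_]; _⊖_) renaming (+_ to pos)
import Data.Integer.Properties as ℤP
open import Data.Integer.Tactic.RingSolver using (solve-∀)
open import Data.Fin using (Fin; zero; suc; toℕ)
open import Data.Fin.Subset using (Subset; _∈_; _∉_; _⊆_; _∩_; ⊤)
open import Data.Fin.Subset.Properties using (_∈?_; ∈⊤; x∈p∩q⁺; x∈p∩q⁻; p∩q⊆p)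
open import Data.Bool using (true; false)
open import Data.Maybe using (just; nothing)
open import Data.Vec using (lookup)
open import Data.Vec.Properties using ([]=⇒lookup; lookup⇒[]=)
import Data.Vec.Functional as Vector
open import Data.List using (List; []; _∷_; _++_; map; concat; concatMap; tabulate)
open import Data.List.Relation.Unary.All as All using (All; []; _∷_)
import Data.List.Relation.Unary.All.Properties as All
open import Data.List.Relation.Unary.Any as Any using (Any; here; there)
open import Data.Product using (∃; _×_; _,_; proj₁; proj₂)
open import Data.Sum as Sum using (_⊎_; inj₁; inj₂)
open import Data.Empty using (⊥-elim)
open import Relation.Nullary using (¬_; yes; no)
open import Relation.Nullary.Decidable using (_⊎-dec_; ¬?; decidable-stable)
open import Relation.Binary.PropositionalEquality
  using (_≡_; refl; sym; trans; cong; cong₂; subst; subst₂; isEquivalence; module ≡-Reasoning)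
open import Function.Bundles using (_⇔_; mk⇔)
open import Algebra.Bundles using (AbelianGroup)
open import Algebra.Structures using (IsAbelianGroup)
import Algebra.Properties.AbelianGroup as AbelianGroupProperties
import Algebra.Properties.CommutativeSemigroup as CommutativeSemigroupProperties
open import Relation.Binary.Definitions using (Transitive; Antisymmetric; Trans; _Respects₂_)
import Relation.Binary.Construct.StrictToNonStrict as StrictToNonStrict
open import Algebra.Properties.Semiring.Sum ℤP.+-*-semiring
  using (sum; sum-cong-≗; sum-replicate-zero; ∑-distrib-+; *-distribˡ-sum)

module IntegerArithmetic where
  open import Data.Integer using (_+_; _*_; -_; _-_; _≤_; _⊔_; 1ℤ)

  open CommutativeSemigroupProperties ℤP.*-commutativeSemigroup using (x∙yz≈y∙xz)

  infix 7 _·_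
  _·_ : ∀ {n} → (Fin n → ℤ) → (Fin n → ℤ) → ℤ
  a · d = sum (λ i → a i * d i)

  ·-scaleʳ : ∀ {n} k (a d : Fin n → ℤ) → a · (λ i → k * d i) ≡ k * (a · d)
  ·-scaleʳ k a d = trans (sum-cong-≗ (λ i → x∙yz≈y∙xz (a i) k (d i))) (sym (*-distribˡ-sum k (λ i → a i * d i)))

  ·-distribʳ-+ : ∀ {n} (a d d' : Fin n → ℤ) → a · (λ i → d i + d' i) ≡ a · d + a · d'
  ·-distribʳ-+ a d d' =
    trans (sum-cong-≗ (λ i → ℤP.*-distribˡ-+ (a i) (d i) (d' i))) (∑-distrib-+ (λ i → a i * d i) (λ i → a i * d' i))

  ·-linearˡ : ∀ {n} k k' (a a' d : Fin n → ℤ) →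
    (λ i → k * a i + k' * a' i) · d ≡ k * (a · d) + k' * (a' · d)
  ·-linearˡ k k' a a' d = begin
    (λ i → k * a i + k' * a' i) · d                      ≡⟨ sum-cong-≗ (λ i → expand k k' (a i) (a' i) (d i)) ⟩
    sum (λ i → k * (a i * d i) + k' * (a' i * d i))      ≡⟨ ∑-distrib-+ (λ i → k * (a i * d i)) (λ i → k' * (a' i * d i)) ⟩
    sum (λ i → k * (a i * d i)) + sum (λ i → k' * (a' i * d i))
      ≡⟨ cong₂ _+_ (*-distribˡ-sum k (λ i → a i * d i)) (*-distribˡ-sum k' (λ i → a' i * d i)) ⟨
    k * (a · d) + k' * (a' · d)                          ∎
    where
    open ≡-Reasoning
    expand : ∀ k k' x x' y → (k * x + k' * x') * y ≡ k * (x * y) + k' * (x' * y)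
    expand = solve-∀

  i≤[1+n]*i : ∀ n {i} → pos 0 ≤ i → i ≤ pos (suc n) * i
  i≤[1+n]*i n {i} 0≤i = begin
    i                       ≡⟨ ℤP.+-identityʳ i ⟨
    i + pos 0               ≡⟨ cong (i +_) (ℤP.*-zeroʳ (pos n)) ⟨
    i + pos n * pos 0       ≤⟨ ℤP.+-monoʳ-≤ i (ℤP.*-monoˡ-≤-nonNeg (pos n) 0≤i) ⟩
    i + pos n * i           ≡⟨ ℤP.suc-* (pos n) i ⟨
    pos (suc n) * i         ∎
    where open ℤP.≤-Reasoning

  module _ {ℓ : Level} {X : Set ℓ} (k : X → ℕ) (g : X → ℤ) where

    -- value / (1 + scale) is the largest of the fractions g x / (1 + k x).
    record ScaledMaximum (xs : List X) : Set ℓ where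
      field
        scale : ℕ
        value : ℤ
        bounds : All (λ x → pos (suc scale) * g x ≤ pos (suc (k x)) * value) xs
        attained : Any (λ x → pos (suc (k x)) * value ≡ pos (suc scale) * g x) xs

    rescale-bound : ∀ n L q y → pos (suc L) * g y ≤ pos (suc (k y)) * q →
      pos (suc n) * pos (suc L) * g y ≤ pos (suc (k y)) * (pos (suc n) * q)
    rescale-bound n L q y h = begin
      pos (suc n) * pos (suc L) * g y      ≡⟨ ℤP.*-assoc (pos (suc n)) (pos (suc L)) (g y) ⟩
      pos (suc n) * (pos (suc L) * g y)    ≤⟨ ℤP.*-monoˡ-≤-nonNeg (pos (suc n)) h ⟩
      pos (suc n) * (pos (suc (k y)) * q)  ≡⟨ x∙yz≈y∙xz (pos (suc n)) (pos (suc (k y))) q ⟩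
      pos (suc (k y)) * (pos (suc n) * q)  ∎
      where open ℤP.≤-Reasoning

    rescale-attained : ∀ n L q y → pos (suc (k y)) * q ≡ pos (suc L) * g y →
      pos (suc (k y)) * (pos (suc n) * q) ≡ pos (suc n) * pos (suc L) * g y
    rescale-attained n L q y e = begin
      pos (suc (k y)) * (pos (suc n) * q)  ≡⟨ x∙yz≈y∙xz (pos (suc (k y))) (pos (suc n)) q ⟩
      pos (suc n) * (pos (suc (k y)) * q)  ≡⟨ cong (pos (suc n) *_) e ⟩
      pos (suc n) * (pos (suc L) * g y)    ≡⟨ ℤP.*-assoc (pos (suc n)) (pos (suc L)) (g y) ⟨
      pos (suc n) * pos (suc L) * g y      ∎
      where open ≡-Reasoning

    scaledMaximum-∷ : ∀ x {xs} → ScaledMaximum xs → ScaledMaximum (x ∷ xs)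
    scaledMaximum-∷ x record { scale = L ; value = q ; bounds = bounds ; attained = attained }
      with pos (suc L) * g x ℤP.≤? pos (suc (k x)) * q
    ... | yes old = record
      { scale = L ℕ.+ k x ℕ.* suc L
      ; value = pos (suc (k x)) * q
      ; bounds = rescale-bound (k x) L q x old ∷ All.map (rescale-bound (k x) L q _) bounds
      ; attained = there (Any.map (rescale-attained (k x) L q _) attained)
      }
    ... | no new = record
      { scale = L ℕ.+ k x ℕ.* suc L
      ; value = pos (suc L) * g x
      ; bounds = ℤP.≤-reflexive (ℤP.*-assoc (pos (suc (k x))) (pos (suc L)) (g x))
               ∷ All.map (λ {y} h → ℤP.≤-trans (rescale-bound (k x) L q y h)
                                              (ℤP.*-monoˡ-≤-nonNeg (pos (suc (k y))) kₓq≤v)) bounds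
      ; attained = here (sym (ℤP.*-assoc (pos (suc (k x))) (pos (suc L)) (g x)))
      }
      where
      kₓq≤v : pos (suc (k x)) * q ≤ pos (suc L) * g x
      kₓq≤v = ℤP.<⇒≤ (ℤP.≰⇒> new)

    scaledMaximum : ∀ xs → xs ≡ [] ⊎ ScaledMaximum xs
    scaledMaximum [] = inj₁ refl
    scaledMaximum (x ∷ xs) with scaledMaximum xs
    ... | inj₁ refl = inj₂ (record { scale = k x ; value = g x ; bounds = ℤP.≤-refl ∷ [] ; attained = here refl })
    ... | inj₂ M = inj₂ (scaledMaximum-∷ x M)

  zeroRow-lift : ∀ e S L q → pos e ≤ S → pos e ≤ pos 0 * q + pos (suc L) * S
  zeroRow-lift e S L q e≤S = begin
    pos e                         ≤⟨ e≤S ⟩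
    S                             ≤⟨ i≤[1+n]*i L (ℤP.≤-trans (ℤ.+≤+ ℕ.z≤n) e≤S) ⟩
    pos (suc L) * S               ≡⟨ ℤP.+-identityˡ _ ⟨
    pos 0 * q + pos (suc L) * S   ∎
    where open ℤP.≤-Reasoning

  posRow-lift : ∀ e S L k q → pos (suc L) * (pos e - S) ≤ pos (suc k) * q →
    pos e ≤ pos (suc k) * q + pos (suc L) * S
  posRow-lift e S L k q h = begin
    pos e                                     ≤⟨ i≤[1+n]*i L (ℤ.+≤+ ℕ.z≤n) ⟩
    pos (suc L) * pos e                       ≡⟨ split (pos (suc L)) (pos e) S ⟩
    pos (suc L) * (pos e - S) + pos (suc L) * S ≤⟨ ℤP.+-monoˡ-≤ (pos (suc L) * S) h ⟩
    pos (suc k) * q + pos (suc L) * S         ∎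
    where
    open ℤP.≤-Reasoning
    split : ∀ l e S → l * e ≡ l * (e - S) + l * S
    split = solve-∀

  -- The bound on q comes from the positive row p at which the scaled maximum is attained,
  -- combined with the negative row r.
  negRow-lift : ∀ j k L eₚ eᵣ Sₚ Sᵣ q →
    pos (suc k) * q ≡ pos (suc L) * (pos eₚ - Sₚ) →
    pos (suc j ℕ.* eₚ ℕ.+ suc k ℕ.* eᵣ) ≤ pos (suc j) * Sₚ + pos (suc k) * Sᵣ →
    pos eᵣ ≤ -[1+ j ] * q + pos (suc L) * Sᵣ
  negRow-lift j k L eₚ eᵣ Sₚ Sᵣ q attained combined = ℤP.*-cancelˡ-≤-pos _ _ a (begin
    a * E                                   ≤⟨ i≤[1+n]*i L (subst (pos 0 ≤_) (ℤP.pos-* (suc k) eᵣ) (ℤ.+≤+ ℕ.z≤n)) ⟩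
    l * (a * E)                             ≤⟨ ℤP.*-monoˡ-≤-nonNeg (pos (suc L)) aE≤ ⟩
    l * (b * Sₚ + a * Sᵣ - b * pos eₚ)      ≡⟨ rearrange a b l (pos eₚ) Sₚ Sᵣ ⟩
    - b * (l * (pos eₚ - Sₚ)) + a * (l * Sᵣ) ≡⟨ cong (λ w → - b * w + a * (l * Sᵣ)) attained ⟨
    - b * (a * q) + a * (l * Sᵣ)            ≡⟨ factor a b l q Sᵣ ⟩
    a * (-[1+ j ] * q + l * Sᵣ)             ∎)
    where
    open ℤP.≤-Reasoning
    a = pos (suc k)
    b = pos (suc j)
    l = pos (suc L)
    E = pos eᵣ
    aE≤ : a * E ≤ b * Sₚ + a * Sᵣ - b * pos eₚ
    aE≤ = ℤP.≤-trans (ℤP.≤-reflexive (cancel (b * pos eₚ) (a * E)))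
      (ℤP.+-monoˡ-≤ (- (b * pos eₚ)) (subst (_≤ b * Sₚ + a * Sᵣ) weights combined))
      where
      weights : pos (suc j ℕ.* eₚ ℕ.+ suc k ℕ.* eᵣ) ≡ b * pos eₚ + a * E
      weights = trans (ℤP.pos-+ (suc j ℕ.* eₚ) (suc k ℕ.* eᵣ)) (cong₂ _+_ (ℤP.pos-* (suc j) eₚ) (ℤP.pos-* (suc k) eᵣ))
      cancel : ∀ x y → y ≡ x + y - x
      cancel = solve-∀
    rearrange : ∀ a b l e Sₚ Sᵣ → l * (b * Sₚ + a * Sᵣ - b * e) ≡ - b * (l * (e - Sₚ)) + a * (l * Sᵣ)
    rearrange = solve-∀
    factor : ∀ a b l q S → - b * (a * q) + a * (l * S) ≡ a * (- b * q + l * S)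
    factor = solve-∀

  negRow-lift-unbounded : ∀ j e S W → pos e - S ≤ W → pos 0 ≤ W → pos e ≤ -[1+ j ] * - W + pos 1 * S
  negRow-lift-unbounded j e S W h 0≤W = begin
    pos e                         ≡⟨ split (pos e) S ⟩
    (pos e - S) + S               ≤⟨ ℤP.+-monoˡ-≤ S h ⟩
    W + S                         ≤⟨ ℤP.+-monoˡ-≤ S (i≤[1+n]*i j 0≤W) ⟩
    pos (suc j) * W + S           ≡⟨ signs (pos (suc j)) W S ⟩
    -[1+ j ] * - W + pos 1 * S    ∎
    where
    open ℤP.≤-Reasoning
    split : ∀ x S → x ≡ (x - S) + S
    split = solve-∀
    signs : ∀ b w S → b * w + S ≡ (- b) * (- w) + 1ℤ * S
    signs = solve-∀

  upperBound : (xs : List ℤ) → ∃ λ W → pos 0 ≤ W × All (_≤ W) xs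
  upperBound [] = pos 0 , ℤP.≤-refl , []
  upperBound (x ∷ xs) with upperBound xs
  ... | W , 0≤W , bound =
    x ⊔ W , ℤP.≤-trans 0≤W (ℤP.i≤j⊔i x W) ,
    ℤP.i≤i⊔j x W ∷ All.map (λ h → ℤP.≤-trans h (ℤP.i≤j⊔i x W)) bound

  unitVec : ∀ {n} → Fin n → ℤ → Fin n → ℤ
  unitVec zero k zero = k
  unitVec zero k (suc j) = pos 0
  unitVec (suc i) k zero = pos 0
  unitVec (suc i) k (suc j) = unitVec i k j

  unitVec-· : ∀ {n} (i : Fin n) k d → unitVec i k · d ≡ k * d i
  unitVec-· {suc n} zero k d =
    trans (cong (k * d zero +_) (trans (sum-cong-≗ (λ j → ℤP.*-zeroˡ (d (suc j)))) (sum-replicate-zero n)))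
          (ℤP.+-identityʳ _)
  unitVec-· (suc i) k d = trans (ℤP.+-identityˡ _) (unitVec-· i k (λ j → d (suc j)))

open IntegerArithmetic

module ZGroupProperties {c : Level} (𝒵 : ZGroup c) where
  open ZGroup 𝒵
  open ZG 𝒵 hiding (_≤_)

  infix 4 _≤_
  _≤_ : Carrier → Carrier → Set c
  _≤_ = ZG._≤_ 𝒵

  private module NonStrict = StrictToNonStrict _≡_ _<_

  +-isAbelianGroup : IsAbelianGroup _≡_ _+_ 0# -_
  +-isAbelianGroup = record
    { isGroup = record
      { isMonoid = record
        { isSemigroup = record
          { isMagma = record { isEquivalence = isEquivalence ; ∙-cong = cong₂ _+_ }
          ; assoc = +-assoc }
        ; identity = (λ x → trans (+-comm 0# x) (+-identityʳ x)) , +-identityʳ }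
      ; inverse = (λ x → trans (+-comm (- x) x) (+-inverseʳ x)) , +-inverseʳ
      ; ⁻¹-cong = cong -_ }
    ; comm = +-comm }

  +-abelianGroup : AbelianGroup c c
  +-abelianGroup = record { isAbelianGroup = +-isAbelianGroup }

  open AbelianGroup +-abelianGroup public
    using (commutativeSemigroup)
    renaming (identityˡ to +-identityˡ; inverseˡ to +-inverseˡ)
  open AbelianGroupProperties +-abelianGroup public
    using ()
    renaming (⁻¹-involutive to neg-involutive; ε⁻¹≈ε to neg-0#)
  open CommutativeSemigroupProperties commutativeSemigroup public
    using (interchange; x∙yz≈y∙xz)

  neg-distrib-+ : ∀ x y → - (x + y) ≡ - x + - y
  neg-distrib-+ x y = sym (AbelianGroupProperties.⁻¹-∙-comm +-abelianGroup x y)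

  +-neg-cancelʳ : ∀ x y → (x + y) + - y ≡ x
  +-neg-cancelʳ x y = trans (+-assoc x y (- y)) (trans (cong (x +_) (+-inverseʳ y)) (+-identityʳ x))

  neg-+-cancelʳ : ∀ x y → (x + - y) + y ≡ x
  neg-+-cancelʳ x y = trans (+-assoc x (- y) y) (trans (cong (x +_) (+-inverseˡ y)) (+-identityʳ x))

  <-resp-≡ : _<_ Respects₂ _≡_
  <-resp-≡ = (λ { refl p → p }) , (λ { refl p → p })

  <-asym : ∀ {x y} → x < y → ¬ (y < x)
  <-asym p q = <-irrefl _ (<-trans p q)

  ≤-refl : ∀ {x} → x ≤ x
  ≤-refl = inj₂ refl

  ≤-trans : Transitive _≤_
  ≤-trans = NonStrict.trans isEquivalence <-resp-≡ <-trans

  <-≤-trans : Trans _<_ _≤_ _<_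
  <-≤-trans = NonStrict.<-≤-trans <-trans (proj₁ <-resp-≡)

  ≤-<-trans : Trans _≤_ _<_ _<_
  ≤-<-trans = NonStrict.≤-<-trans sym <-trans (proj₂ <-resp-≡)

  ≤⇒≯ : ∀ {x y} → x ≤ y → ¬ (y < x)
  ≤⇒≯ (inj₁ p) q = <-asym p q
  ≤⇒≯ (inj₂ refl) q = <-irrefl _ q

  ≤-antisym : Antisymmetric _≡_ _≤_
  ≤-antisym = NonStrict.antisym isEquivalence <-trans (λ { refl → <-irrefl _ })

  +-monoˡ-< : ∀ z {x y} → x < y → z + x < z + y
  +-monoˡ-< z {x} {y} p = subst₂ _<_ (+-comm x z) (+-comm y z) (<-+-compat x y z p)

  +-monoʳ-≤ : ∀ z {x y} → x ≤ y → x + z ≤ y + z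
  +-monoʳ-≤ z (inj₁ p) = inj₁ (<-+-compat _ _ z p)
  +-monoʳ-≤ z (inj₂ refl) = ≤-refl

  +-monoˡ-≤ : ∀ z {x y} → x ≤ y → z + x ≤ z + y
  +-monoˡ-≤ z {x} {y} p = subst₂ _≤_ (+-comm x z) (+-comm y z) (+-monoʳ-≤ z p)

  +-mono-≤ : ∀ {x y u v} → x ≤ y → u ≤ v → x + u ≤ y + v
  +-mono-≤ {y = y} {u} p q = ≤-trans (+-monoʳ-≤ u p) (+-monoˡ-≤ y q)

  +-mono-<-≤ : ∀ {x y u v} → x < y → u ≤ v → x + u < y + v
  +-mono-<-≤ {x} {y} {u} p q = <-≤-trans (<-+-compat x y u p) (+-monoˡ-≤ y q)

  +-cancelʳ-≤ : ∀ z {x y} → x + z ≤ y + z → x ≤ y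
  +-cancelʳ-≤ z {x} {y} p = subst₂ _≤_ (+-neg-cancelʳ x z) (+-neg-cancelʳ y z) (+-monoʳ-≤ (- z) p)

  x≤x+y : ∀ x {y} → 0# ≤ y → x ≤ x + y
  x≤x+y x {y} p = subst (_≤ x + y) (+-identityʳ x) (+-monoˡ-≤ x p)

  +-nonneg : ∀ {x y} → 0# ≤ x → 0# ≤ y → 0# ≤ x + y
  +-nonneg p q = subst (_≤ _) (+-identityʳ 0#) (+-mono-≤ p q)

  neg-mono-< : ∀ {x y} → x < y → - y < - x
  neg-mono-< {x} {y} p = subst₂ _<_ (cancel x y) (trans (cong (y +_) (+-comm (- x) (- y))) (cancel y x))
    (<-+-compat x y (- x + - y) p)
    where
    cancel : ∀ u v → u + (- u + - v) ≡ - v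
    cancel u v = trans (sym (+-assoc u (- u) (- v))) (trans (cong (_+ - v) (+-inverseʳ u)) (+-identityˡ (- v)))

  0≤1 : 0# ≤ 1#
  0≤1 = inj₁ 0<1

  x<x+1 : ∀ x → x < x + 1#
  x<x+1 x = subst (_< x + 1#) (+-identityʳ x) (+-monoˡ-< x 0<1)

  <⇒+1≤ : ∀ {x y} → x < y → x + 1# ≤ y
  <⇒+1≤ {x} {y} p with 1-least (y + - x) (subst (_< y + - x) (+-inverseʳ x) (<-+-compat x y (- x) p))
  ... | inj₁ e = inj₂ (trans (+-comm x 1#) (trans (cong (_+ x) e) (neg-+-cancelʳ y x)))
  ... | inj₂ q = inj₁ (subst₂ _<_ (+-comm 1# x) (neg-+-cancelʳ y x) (<-+-compat _ _ x q))

  abs : Carrier → Carrier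
  abs x with <-trichotomy x 0#
  ... | inj₁ _ = - x
  ... | inj₂ _ = x

  abs-nonneg : ∀ x → 0# ≤ abs x
  abs-nonneg x with <-trichotomy x 0#
  ... | inj₁ p = inj₁ (subst (_< - x) neg-0# (neg-mono-< p))
  ... | inj₂ (inj₁ e) = inj₂ (sym e)
  ... | inj₂ (inj₂ p) = inj₁ p

  x≤abs : ∀ x → x ≤ abs x
  x≤abs x with <-trichotomy x 0#
  ... | inj₁ p = inj₁ (<-trans p (subst (_< - x) neg-0# (neg-mono-< p)))
  ... | inj₂ _ = ≤-refl

  0≤x+abs : ∀ x → 0# ≤ x + abs x
  0≤x+abs x with <-trichotomy x 0#
  ... | inj₁ p = inj₂ (sym (+-inverseʳ x))
  ... | inj₂ (inj₁ refl) = inj₂ (sym (+-identityʳ 0#))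
  ... | inj₂ (inj₂ p) = +-nonneg (inj₁ p) (inj₁ p)

  ×ₙ-homo-+ : ∀ m n x → (m ℕ.+ n) ×ₙ x ≡ m ×ₙ x + n ×ₙ x
  ×ₙ-homo-+ zero n x = sym (+-identityˡ _)
  ×ₙ-homo-+ (suc m) n x = trans (cong (x +_) (×ₙ-homo-+ m n x)) (sym (+-assoc x _ _))

  ×ₙ-distrib-+ : ∀ n x y → n ×ₙ (x + y) ≡ n ×ₙ x + n ×ₙ y
  ×ₙ-distrib-+ zero x y = sym (+-identityʳ 0#)
  ×ₙ-distrib-+ (suc n) x y = trans (cong ((x + y) +_) (×ₙ-distrib-+ n x y)) (interchange x y _ _)

  ×ₙ-assoc : ∀ m n x → (m ℕ.* n) ×ₙ x ≡ m ×ₙ (n ×ₙ x)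
  ×ₙ-assoc zero n x = refl
  ×ₙ-assoc (suc m) n x = trans (×ₙ-homo-+ n (m ℕ.* n) x) (cong (n ×ₙ x +_) (×ₙ-assoc m n x))

  ×ₙ-comm : ∀ m n x → m ×ₙ (n ×ₙ x) ≡ n ×ₙ (m ×ₙ x)
  ×ₙ-comm m n x = trans (sym (×ₙ-assoc m n x)) (trans (cong (_×ₙ x) (ℕP.*-comm m n)) (×ₙ-assoc n m x))

  ×ₙ-zeroʳ : ∀ n → n ×ₙ 0# ≡ 0#
  ×ₙ-zeroʳ zero = refl
  ×ₙ-zeroʳ (suc n) = trans (+-identityˡ _) (×ₙ-zeroʳ n)

  ×ₙ-neg : ∀ n x → n ×ₙ (- x) ≡ - (n ×ₙ x)
  ×ₙ-neg zero x = sym neg-0#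
  ×ₙ-neg (suc n) x = trans (cong (- x +_) (×ₙ-neg n x)) (sym (neg-distrib-+ x _))

  ×ₙ-monoʳ-≤ : ∀ n {x y} → x ≤ y → n ×ₙ x ≤ n ×ₙ y
  ×ₙ-monoʳ-≤ zero p = ≤-refl
  ×ₙ-monoʳ-≤ (suc n) p = +-mono-≤ p (×ₙ-monoʳ-≤ n p)

  ×ₙ-monoʳ-< : ∀ n {x y} → x < y → suc n ×ₙ x < suc n ×ₙ y
  ×ₙ-monoʳ-< n p = +-mono-<-≤ p (×ₙ-monoʳ-≤ n (inj₁ p))

  ×ₙ-nonneg : ∀ n {x} → 0# ≤ x → 0# ≤ n ×ₙ x
  ×ₙ-nonneg n {x} p = subst (_≤ n ×ₙ x) (×ₙ-zeroʳ n) (×ₙ-monoʳ-≤ n p)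

  x≤n×x : ∀ n .{{_ : NonZero n}} {x} → 0# ≤ x → x ≤ n ×ₙ x
  x≤n×x (suc n) p = x≤x+y _ (×ₙ-nonneg n p)

  ×ₙ-cancelʳ-< : ∀ n {x y} → suc n ×ₙ x < suc n ×ₙ y → x < y
  ×ₙ-cancelʳ-< n {x} {y} p with <-trichotomy x y
  ... | inj₁ q = q
  ... | inj₂ (inj₁ refl) = ⊥-elim (<-irrefl _ p)
  ... | inj₂ (inj₂ q) = ⊥-elim (<-asym p (×ₙ-monoʳ-< n q))

  ×ₙ-cancelʳ-≡ : ∀ n {x y} → suc n ×ₙ x ≡ suc n ×ₙ y → x ≡ y
  ×ₙ-cancelʳ-≡ n {x} {y} e with <-trichotomy x y
  ... | inj₁ q = ⊥-elim (<-irrefl _ (subst (_< suc n ×ₙ y) e (×ₙ-monoʳ-< n q)))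
  ... | inj₂ (inj₁ e') = e'
  ... | inj₂ (inj₂ q) = ⊥-elim (<-irrefl _ (subst (suc n ×ₙ y <_) e (×ₙ-monoʳ-< n q)))

  ⊖-×ℤ : ∀ m n x → (m ⊖ n) ×ℤ x ≡ m ×ₙ x + - (n ×ₙ x)
  ⊖-×ℤ zero zero x = sym (trans (cong (0# +_) neg-0#) (+-identityʳ 0#))
  ⊖-×ℤ zero (suc n) x = sym (+-identityˡ _)
  ⊖-×ℤ (suc m) zero x = sym (trans (cong (_ +_) neg-0#) (+-identityʳ _))
  ⊖-×ℤ (suc m) (suc n) x = begin
    (suc m ⊖ suc n) ×ℤ x              ≡⟨ cong (_×ℤ x) (ℤP.[1+m]⊖[1+n]≡m⊖n m n) ⟩
    (m ⊖ n) ×ℤ x                      ≡⟨ ⊖-×ℤ m n x ⟩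
    m ×ₙ x + - (n ×ₙ x)               ≡⟨ +-identityˡ _ ⟨
    0# + (m ×ₙ x + - (n ×ₙ x))        ≡⟨ cong (_+ (m ×ₙ x + - (n ×ₙ x))) (+-inverseʳ x) ⟨
    (x + - x) + (m ×ₙ x + - (n ×ₙ x)) ≡⟨ interchange x _ (- x) _ ⟨
    (x + m ×ₙ x) + (- x + - (n ×ₙ x)) ≡⟨ cong ((x + m ×ₙ x) +_) (neg-distrib-+ x _) ⟨
    (x + m ×ₙ x) + - (x + n ×ₙ x)     ∎
    where open ≡-Reasoning

  ×ℤ-homo-+ : ∀ i j x → (i ℤ.+ j) ×ℤ x ≡ i ×ℤ x + j ×ℤ x
  ×ℤ-homo-+ (pos m) (pos n) x = ×ₙ-homo-+ m n x
  ×ℤ-homo-+ (pos m) -[1+ n ] x = ⊖-×ℤ m (suc n) x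
  ×ℤ-homo-+ -[1+ m ] (pos n) x = trans (⊖-×ℤ n (suc m) x) (+-comm _ _)
  ×ℤ-homo-+ -[1+ m ] -[1+ n ] x = trans (cong -_ (trans (cong (λ k → suc k ×ₙ x) (sym (ℕP.+-suc m n)))
    (×ₙ-homo-+ (suc m) (suc n) x))) (neg-distrib-+ _ _)

  ×ℤ-neg : ∀ i x → (ℤ.- i) ×ℤ x ≡ - (i ×ℤ x)
  ×ℤ-neg (pos zero) x = sym neg-0#
  ×ℤ-neg (pos (suc n)) x = refl
  ×ℤ-neg -[1+ n ] x = sym (neg-involutive _)

  ×ℤ-distrib-+ : ∀ i x y → i ×ℤ (x + y) ≡ i ×ℤ x + i ×ℤ y
  ×ℤ-distrib-+ (pos n) x y = ×ₙ-distrib-+ n x y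
  ×ℤ-distrib-+ -[1+ n ] x y = trans (cong -_ (×ₙ-distrib-+ (suc n) x y)) (neg-distrib-+ _ _)

  ×ℤ-zeroʳ : ∀ i → i ×ℤ 0# ≡ 0#
  ×ℤ-zeroʳ (pos n) = ×ₙ-zeroʳ n
  ×ℤ-zeroʳ -[1+ n ] = trans (cong -_ (×ₙ-zeroʳ (suc n))) neg-0#

  ×ℤ-assocₙ : ∀ n i x → (pos n ℤ.* i) ×ℤ x ≡ n ×ₙ (i ×ℤ x)
  ×ℤ-assocₙ zero i x = cong (_×ℤ x) (ℤP.*-zeroˡ i)
  ×ℤ-assocₙ (suc n) i x = begin
    (pos (suc n) ℤ.* i) ×ℤ x     ≡⟨ cong (_×ℤ x) (ℤP.suc-* (pos n) i) ⟩
    (i ℤ.+ pos n ℤ.* i) ×ℤ x     ≡⟨ ×ℤ-homo-+ i (pos n ℤ.* i) x ⟩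
    i ×ℤ x + (pos n ℤ.* i) ×ℤ x ≡⟨ cong (i ×ℤ x +_) (×ℤ-assocₙ n i x) ⟩
    i ×ℤ x + n ×ₙ (i ×ℤ x)      ∎
    where open ≡-Reasoning

  ×ℤ-assoc : ∀ i j x → (i ℤ.* j) ×ℤ x ≡ i ×ℤ (j ×ℤ x)
  ×ℤ-assoc (pos n) j x = ×ℤ-assocₙ n j x
  ×ℤ-assoc -[1+ n ] j x = begin
    (-[1+ n ] ℤ.* j) ×ℤ x         ≡⟨ cong (_×ℤ x) (ℤP.neg-distribˡ-* (pos (suc n)) j) ⟨
    (ℤ.- (pos (suc n) ℤ.* j)) ×ℤ x ≡⟨ ×ℤ-neg (pos (suc n) ℤ.* j) x ⟩
    - ((pos (suc n) ℤ.* j) ×ℤ x)   ≡⟨ cong -_ (×ℤ-assocₙ (suc n) j x) ⟩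
    - (suc n ×ₙ (j ×ℤ x))          ∎
    where open ≡-Reasoning

  ×ℤ-×ₙ-comm : ∀ i n x → i ×ℤ (n ×ₙ x) ≡ n ×ₙ (i ×ℤ x)
  ×ℤ-×ₙ-comm i n x = trans (sym (×ℤ-assoc i (pos n) x))
    (trans (cong (_×ℤ x) (ℤP.*-comm i (pos n))) (×ℤ-assocₙ n i x))

  ×ℤ-nonneg : ∀ i {x} → pos 0 ℤ.≤ i → 0# ≤ x → 0# ≤ i ×ℤ x
  ×ℤ-nonneg (pos n) _ p = ×ₙ-nonneg n p

  sumFin-cong : ∀ {m} {f g : Fin m → Carrier} → (∀ i → f i ≡ g i) → sumFin f ≡ sumFin g
  sumFin-cong {zero} e = refl
  sumFin-cong {suc m} e = cong₂ _+_ (e zero) (sumFin-cong (λ i → e (suc i)))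

  sumFin-distrib-+ : ∀ {m} (f g : Fin m → Carrier) → sumFin (λ i → f i + g i) ≡ sumFin f + sumFin g
  sumFin-distrib-+ {zero} f g = sym (+-identityʳ 0#)
  sumFin-distrib-+ {suc m} f g =
    trans (cong ((f zero + g zero) +_) (sumFin-distrib-+ (λ i → f (suc i)) (λ i → g (suc i)))) (interchange _ _ _ _)

  sumFin-zero : ∀ {m} → sumFin {m} (λ _ → 0#) ≡ 0#
  sumFin-zero {zero} = refl
  sumFin-zero {suc m} = trans (+-identityˡ _) (sumFin-zero {m})

  sumFin-×ₙ : ∀ {m} n (f : Fin m → Carrier) → sumFin (λ i → n ×ₙ f i) ≡ n ×ₙ sumFin f
  sumFin-×ₙ {zero} n f = sym (×ₙ-zeroʳ n)
  sumFin-×ₙ {suc m} n f = trans (cong (n ×ₙ f zero +_) (sumFin-×ₙ n (λ i → f (suc i)))) (sym (×ₙ-distrib-+ n _ _))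

  sumFin-mono-≤ : ∀ {m} {f g : Fin m → Carrier} → (∀ i → f i ≤ g i) → sumFin f ≤ sumFin g
  sumFin-mono-≤ {zero} p = ≤-refl
  sumFin-mono-≤ {suc m} p = +-mono-≤ (p zero) (sumFin-mono-≤ (λ i → p (suc i)))

  sumFin-nonneg : ∀ {m} {f : Fin m → Carrier} → (∀ i → 0# ≤ f i) → 0# ≤ sumFin f
  sumFin-nonneg {m} {f} p = subst (_≤ sumFin f) (sumFin-zero {m}) (sumFin-mono-≤ p)

  ≤-sumFin : ∀ {m} (f : Fin m → Carrier) → (∀ i → 0# ≤ f i) → ∀ i → f i ≤ sumFin f
  ≤-sumFin f p zero = x≤x+y (f zero) (sumFin-nonneg (λ i → p (suc i)))
  ≤-sumFin f p (suc i) = subst (_≤ sumFin f) (+-identityˡ (f (suc i)))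
    (+-mono-≤ (p zero) (≤-sumFin (λ i → f (suc i)) (λ i → p (suc i)) i))

  sumFin-×ℤ : ∀ {n} (g : Fin n → ℤ) t → sumFin (λ i → g i ×ℤ t) ≡ sum g ×ℤ t
  sumFin-×ℤ {zero} g t = refl
  sumFin-×ℤ {suc n} g t = trans (cong (g zero ×ℤ t +_) (sumFin-×ℤ (λ i → g (suc i)) t)) (sym (×ℤ-homo-+ (g zero) _ t))

  ≡[]-+-multiple : ∀ {x r} n w → x ≡[ n ] r → (x + n ×ₙ w) ≡[ n ] r
  ≡[]-+-multiple {x} {r} n w (z , x≡r+nz) = z + w ,
    trans (cong (_+ n ×ₙ w) x≡r+nz) (trans (+-assoc r _ _) (cong (r +_) (sym (×ₙ-distrib-+ n z w))))

module FourierMotzkin {c : Level} (𝒵 : ZGroup c) where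
  open ZGroup 𝒵
  open ZG 𝒵 hiding (_≤_)
  open ZGroupProperties 𝒵

  infix 7 _⊛_
  _⊛_ : ∀ {n} → (Fin n → ℤ) → (Fin n → Carrier) → Carrier
  a ⊛ v = sumFin (λ i → a i ×ℤ v i)

  ⊛-linearˡ : ∀ {n} j k (a a' : Fin n → ℤ) v →
    (λ i → pos (suc j) ℤ.* a i ℤ.+ pos (suc k) ℤ.* a' i) ⊛ v ≡ suc j ×ₙ (a ⊛ v) + suc k ×ₙ (a' ⊛ v)
  ⊛-linearˡ j k a a' v = begin
    sumFin (λ i → (pos (suc j) ℤ.* a i ℤ.+ pos (suc k) ℤ.* a' i) ×ℤ v i)
      ≡⟨ sumFin-cong (λ i → trans (×ℤ-homo-+ (pos (suc j) ℤ.* a i) _ (v i))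
                                  (cong₂ _+_ (×ℤ-assocₙ (suc j) (a i) (v i)) (×ℤ-assocₙ (suc k) (a' i) (v i)))) ⟩
    sumFin (λ i → suc j ×ₙ (a i ×ℤ v i) + suc k ×ₙ (a' i ×ℤ v i))
      ≡⟨ sumFin-distrib-+ (λ i → suc j ×ₙ (a i ×ℤ v i)) (λ i → suc k ×ₙ (a' i ×ℤ v i)) ⟩
    sumFin (λ i → suc j ×ₙ (a i ×ℤ v i)) + sumFin (λ i → suc k ×ₙ (a' i ×ℤ v i))
      ≡⟨ cong₂ _+_ (sumFin-×ₙ (suc j) (λ i → a i ×ℤ v i)) (sumFin-×ₙ (suc k) (λ i → a' i ×ℤ v i)) ⟩
    suc j ×ₙ (a ⊛ v) + suc k ×ₙ (a' ⊛ v) ∎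
    where open ≡-Reasoning

  unitVec-⊛ : ∀ {n} (i : Fin n) k u → unitVec i k ⊛ u ≡ k ×ℤ u i
  unitVec-⊛ {suc n} zero k u = trans (cong (k ×ℤ u zero +_) (sumFin-zero {n})) (+-identityʳ _)
  unitVec-⊛ (suc i) k u = trans (+-identityˡ _) (unitVec-⊛ i k (λ j → u (suc j)))

  -- A row (a, e, f) is the constraint  e·B + f ≤ a ⊛ v  on v ∈ 𝒵ⁿ, for a parameter B ∈ 𝒵,
  -- and the homogeneous constraint  e ≤ a · d  on d ∈ ℤⁿ.
  record Row (n : ℕ) : Set c where
    constructor row
    field
      coeff : Fin n → ℤ
      weight : ℕ
      offset : Carrier
  open Row public

  Sat : ∀ {n} → Carrier → (Fin n → Carrier) → Row n → Set c
  Sat B v r = weight r ×ₙ B + offset r ≤ coeff r ⊛ v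

  SatDir : ∀ {n} → (Fin n → ℤ) → Row n → Set
  SatDir d r = pos (weight r) ℤ.≤ coeff r · d

  -- The constraints imposed on v₀ ∷ v, resp. q ∷ d, by a row with leading coefficient h and tail t.
  SatWith : ∀ {n} → Carrier → Carrier → (Fin n → Carrier) → ℤ → Row n → Set c
  SatWith B v₀ v h t = weight t ×ₙ B + offset t ≤ h ×ℤ v₀ + coeff t ⊛ v

  SatDirWith : ∀ {n} → ℤ → (Fin n → ℤ) → ℤ → Row n → Set
  SatDirWith q d h t = pos (weight t) ℤ.≤ h ℤ.* q ℤ.+ coeff t · d

  tailRow : ∀ {n} → Row (suc n) → Row n
  tailRow r = row (λ i → coeff r (suc i)) (weight r) (offset r)

  -- Rows split by the sign of their leading coefficient; a pair (k , t) records the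
  -- coefficient +(1 + k), resp. −(1 + k).
  record Partition (n : ℕ) : Set c where
    field
      zeros : List (Row n)
      positives : List (ℕ × Row n)
      negatives : List (ℕ × Row n)
  open Partition

  AllPartition : ∀ {ℓ n} → (ℤ → Row n → Set ℓ) → Partition n → Set (c Level.⊔ ℓ)
  AllPartition Q π = All (Q (pos 0)) (zeros π)
    × All (λ (k , t) → Q (pos (suc k)) t) (positives π)
    × All (λ (k , t) → Q -[1+ k ] t) (negatives π)

  insert : ∀ {n} → ℤ → Row n → Partition n → Partition n
  insert (pos zero) t π = record π { zeros = t ∷ zeros π }
  insert (pos (suc k)) t π = record π { positives = (k , t) ∷ positives π }
  insert -[1+ k ] t π = record π { negatives = (k , t) ∷ negatives π }

  partition : ∀ {n} → List (Row (suc n)) → Partition n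
  partition [] = record { zeros = [] ; positives = [] ; negatives = [] }
  partition (r ∷ rs) = insert (coeff r zero) (tailRow r) (partition rs)

  module _ {ℓ n} (Q : ℤ → Row n → Set ℓ) where

    insert-All⁺ : ∀ h t π → Q h t → AllPartition Q π → AllPartition Q (insert h t π)
    insert-All⁺ (pos zero) t π q (zs , ps , ns) = q ∷ zs , ps , ns
    insert-All⁺ (pos (suc k)) t π q (zs , ps , ns) = zs , q ∷ ps , ns
    insert-All⁺ -[1+ k ] t π q (zs , ps , ns) = zs , ps , q ∷ ns

    insert-All⁻ : ∀ h t π → AllPartition Q (insert h t π) → Q h t × AllPartition Q π
    insert-All⁻ (pos zero) t π (q ∷ zs , ps , ns) = q , zs , ps , ns
    insert-All⁻ (pos (suc k)) t π (zs , q ∷ ps , ns) = q , zs , ps , ns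
    insert-All⁻ -[1+ k ] t π (zs , ps , q ∷ ns) = q , zs , ps , ns

    partition-All⁺ : (rs : List (Row (suc n))) →
      All (λ r → Q (coeff r zero) (tailRow r)) rs → AllPartition Q (partition rs)
    partition-All⁺ [] [] = [] , [] , []
    partition-All⁺ (r ∷ rs) (q ∷ qs) = insert-All⁺ (coeff r zero) (tailRow r) (partition rs) q (partition-All⁺ rs qs)

    partition-All⁻ : (rs : List (Row (suc n))) →
      AllPartition Q (partition rs) → All (λ r → Q (coeff r zero) (tailRow r)) rs
    partition-All⁻ [] _ = []
    partition-All⁻ (r ∷ rs) all with insert-All⁻ (coeff r zero) (tailRow r) (partition rs) all
    ... | q , qs = q ∷ partition-All⁻ rs qs

  -- (1 + j)·p + (1 + k)·r, in which the leading variable cancels.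
  combine : ∀ {n} → ℕ × Row n → ℕ × Row n → Row n
  combine (k , p) (j , r) = row
    (λ i → pos (suc j) ℤ.* coeff p i ℤ.+ pos (suc k) ℤ.* coeff r i)
    (suc j ℕ.* weight p ℕ.+ suc k ℕ.* weight r)
    (suc j ×ₙ offset p + suc k ×ₙ offset r)

  combinations : ∀ {n} → List (ℕ × Row n) → List (ℕ × Row n) → List (Row n)
  combinations P N = concatMap (λ p → map (combine p) N) P

  eliminate : ∀ {n} → List (Row (suc n)) → List (Row n)
  eliminate rs = zeros (partition rs) ++ combinations (positives (partition rs)) (negatives (partition rs))

  module _ {ℓ n} {Q : Row n → Set ℓ} where

    combinations-All⁺ : ∀ P N → All (λ p → All (λ r → Q (combine p r)) N) P → All Q (combinations P N)
    combinations-All⁺ P N h = All.concat⁺ (All.map⁺ (All.map All.map⁺ h))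

    combinations-All⁻ : ∀ P N → All Q (combinations P N) → All (λ p → All (λ r → Q (combine p r)) N) P
    combinations-All⁻ P N h = All.map All.map⁻ (All.map⁻ (All.concat⁻ h))

  ×ₙ-combine : ∀ J K x y x' y' → J ×ₙ (x + y) + K ×ₙ (x' + y') ≡ (J ×ₙ x + K ×ₙ x') + (J ×ₙ y + K ×ₙ y')
  ×ₙ-combine J K x y x' y' = trans (cong₂ _+_ (×ₙ-distrib-+ J x y) (×ₙ-distrib-+ K x' y')) (interchange _ _ _ _)

  combine-sat : ∀ {n} B v₀ (v : Fin n → Carrier) k j p r →
    SatWith B v₀ v (pos (suc k)) p → SatWith B v₀ v -[1+ j ] r → Sat B v (combine (k , p) (j , r))
  combine-sat B v₀ v k j p r satₚ satᵣ =
    subst₂ _≤_ lhs rhs (+-mono-≤ (×ₙ-monoʳ-≤ (suc j) satₚ) (×ₙ-monoʳ-≤ (suc k) satᵣ))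
    where
    open ≡-Reasoning
    J = suc j
    K = suc k
    offsets = J ×ₙ offset p + K ×ₙ offset r
    lhs : J ×ₙ (weight p ×ₙ B + offset p) + K ×ₙ (weight r ×ₙ B + offset r)
        ≡ (J ℕ.* weight p ℕ.+ K ℕ.* weight r) ×ₙ B + (J ×ₙ offset p + K ×ₙ offset r)
    lhs = begin
      J ×ₙ (weight p ×ₙ B + offset p) + K ×ₙ (weight r ×ₙ B + offset r)
        ≡⟨ ×ₙ-combine J K _ _ _ _ ⟩
      (J ×ₙ (weight p ×ₙ B) + K ×ₙ (weight r ×ₙ B)) + (J ×ₙ offset p + K ×ₙ offset r)
        ≡⟨ cong (_+ offsets) (cong₂ _+_ (×ₙ-assoc J (weight p) B) (×ₙ-assoc K (weight r) B)) ⟨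
      ((J ℕ.* weight p) ×ₙ B + (K ℕ.* weight r) ×ₙ B) + (J ×ₙ offset p + K ×ₙ offset r)
        ≡⟨ cong (_+ offsets) (×ₙ-homo-+ (J ℕ.* weight p) (K ℕ.* weight r) B) ⟨
      (J ℕ.* weight p ℕ.+ K ℕ.* weight r) ×ₙ B + (J ×ₙ offset p + K ×ₙ offset r) ∎
    v₀-cancels : J ×ₙ (K ×ₙ v₀) + K ×ₙ (- (J ×ₙ v₀)) ≡ 0#
    v₀-cancels = trans (cong₂ _+_ (×ₙ-comm J K v₀) (×ₙ-neg K (J ×ₙ v₀))) (+-inverseʳ _)
    rhs : J ×ₙ (K ×ₙ v₀ + coeff p ⊛ v) + K ×ₙ (- (J ×ₙ v₀) + coeff r ⊛ v) ≡ coeff (combine (k , p) (j , r)) ⊛ v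
    rhs = begin
      J ×ₙ (K ×ₙ v₀ + coeff p ⊛ v) + K ×ₙ (- (J ×ₙ v₀) + coeff r ⊛ v)
        ≡⟨ ×ₙ-combine J K _ _ _ _ ⟩
      (J ×ₙ (K ×ₙ v₀) + K ×ₙ (- (J ×ₙ v₀))) + (J ×ₙ (coeff p ⊛ v) + K ×ₙ (coeff r ⊛ v))
        ≡⟨ trans (cong (_+ (J ×ₙ (coeff p ⊛ v) + K ×ₙ (coeff r ⊛ v))) v₀-cancels) (+-identityˡ _) ⟩
      J ×ₙ (coeff p ⊛ v) + K ×ₙ (coeff r ⊛ v)
        ≡⟨ ⊛-linearˡ j k (coeff p) (coeff r) v ⟨
      coeff (combine (k , p) (j , r)) ⊛ v ∎

  eliminate-sat : ∀ {n} B (v : Fin (suc n) → Carrier) rs →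
    All (Sat B v) rs → All (Sat B (Vector.tail v)) (eliminate rs)
  eliminate-sat B v rs sat with partition-All⁺ (SatWith B (v zero) (Vector.tail v)) rs sat
  ... | zs , ps , ns = All.++⁺ (All.map (λ h → subst (_ ≤_) (+-identityˡ _) h) zs)
    (combinations-All⁺ _ _ (All.map (λ {(k , p)} sp → All.map (λ {(j , r)} sr → combine-sat B (v zero) _ k j p r sp sr) ns) ps))

  module _ {n} (d' : Fin n → ℤ) where

    scaled : ℕ → Fin n → ℤ
    scaled L i = pos (suc L) ℤ.* d' i

    lift-sat : ∀ q L h t → pos (weight t) ℤ.≤ h ℤ.* q ℤ.+ pos (suc L) ℤ.* (coeff t · d') →
      SatDirWith q (scaled L) h t
    lift-sat q L h t = subst (λ w → pos (weight t) ℤ.≤ h ℤ.* q ℤ.+ w) (sym (·-scaleʳ (pos (suc L)) (coeff t) d'))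

    lift-zeros : ∀ q L {Z} → All (SatDir d') Z → All (SatDirWith q (scaled L) (pos 0)) Z
    lift-zeros q L = All.map (λ {t} h → lift-sat q L (pos 0) t (zeroRow-lift _ _ L q h))

    -- Without positive rows the leading entry only needs to be small enough.
    lift-withoutPositives : ∀ Z P N → P ≡ [] → All (SatDir d') Z →
      ∃ λ q → ∃ λ L → AllPartition (SatDirWith q (scaled L)) (record { zeros = Z ; positives = P ; negatives = N })
    lift-withoutPositives Z .[] N refl sat with upperBound (map (λ (_ , r) → pos (weight r) ℤ.- coeff r · d') N)
    ... | W , 0≤W , bound = ℤ.- W , 0 , lift-zeros (ℤ.- W) 0 sat , [] ,
      All.map (λ {(j , r)} h → lift-sat (ℤ.- W) 0 -[1+ j ] r (negRow-lift-unbounded j (weight r) (coeff r · d') W h 0≤W))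
              (All.map⁻ bound)

    lift-withPositives : ∀ Z P N → All (SatDir d') Z → All (λ p → All (λ r → SatDir d' (combine p r)) N) P →
      ScaledMaximum proj₁ (λ (_ , p) → pos (weight p) ℤ.- coeff p · d') P →
      ∃ λ q → ∃ λ L → AllPartition (SatDirWith q (scaled L)) (record { zeros = Z ; positives = P ; negatives = N })
    lift-withPositives Z P N satZ satC M = q , L , lift-zeros q L satZ ,
      All.map (λ {(k , p)} h → lift-sat q L (pos (suc k)) p (posRow-lift (weight p) (coeff p · d') L k q h)) bounds ,
      All.lookupWith (λ {(k , p)} → negatives-lift k p) satC attained
      where
      open ScaledMaximum M renaming (scale to L; value to q)
      negatives-lift : ∀ k p → All (λ r → SatDir d' (combine (k , p) r)) N →
        pos (suc k) ℤ.* q ≡ pos (suc L) ℤ.* (pos (weight p) ℤ.- coeff p · d') →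
        All (λ (j , r) → SatDirWith q (scaled L) -[1+ j ] r) N
      negatives-lift k p combined attainedₚ = All.map (λ {(j , r)} h → lift-sat q L -[1+ j ] r
        (negRow-lift j k L (weight p) (weight r) (coeff p · d') (coeff r · d') q attainedₚ
          (subst (_ ℤ.≤_) (·-linearˡ (pos (suc j)) (pos (suc k)) (coeff p) (coeff r) d') h))) combined

  partition-lift : ∀ {n} (d' : Fin n → ℤ) π → All (SatDir d') (zeros π ++ combinations (positives π) (negatives π)) →
    ∃ λ q → ∃ λ L → AllPartition (SatDirWith q (scaled d' L)) π
  partition-lift d' π sat with All.++⁻ (zeros π) sat
  ... | satZ , satC with scaledMaximum proj₁ (λ (_ , p) → pos (weight p) ℤ.- coeff p · d') (positives π)
  ... | inj₁ none = lift-withoutPositives d' _ _ _ none satZ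
  ... | inj₂ M = lift-withPositives d' _ _ _ satZ (combinations-All⁻ _ _ satC) M

  eliminate-lift : ∀ {n} (rs : List (Row (suc n))) (d' : Fin n → ℤ) →
    All (SatDir d') (eliminate rs) → ∃ λ d → All (SatDir d) rs
  eliminate-lift rs d' sat with partition-lift d' (partition rs) sat
  ... | q , L , lifted = q Vector.∷ scaled d' L , partition-All⁻ (SatDirWith q (scaled d' L)) rs lifted

  -- For B = |f| + 1 the left-hand side (1 + e)·B + f is positive.
  bounded⇒weight≡0 : ∀ e f → (∀ B → e ×ₙ B + f ≤ 0#) → pos e ℤ.≤ pos 0
  bounded⇒weight≡0 zero f _ = ℤP.≤-refl
  bounded⇒weight≡0 (suc e) f bounded = ⊥-elim (≤⇒≯ (bounded B) (<-≤-trans 0<B+f (+-monoʳ-≤ f (x≤n×x (suc e) 0≤B))))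
    where
    B = abs f + 1#
    0≤B : 0# ≤ B
    0≤B = +-nonneg (abs-nonneg f) 0≤1
    0<B+f : 0# < B + f
    0<B+f = ≤-<-trans (0≤x+abs f) (subst (f + abs f <_) reorder (x<x+1 (f + abs f)))
      where
      reorder : (f + abs f) + 1# ≡ (abs f + 1#) + f
      reorder = trans (cong (_+ 1#) (+-comm f (abs f))) (trans (+-assoc _ f 1#)
        (trans (cong (abs f +_) (+-comm f 1#)) (sym (+-assoc _ 1# f))))

  noVariables-direction : (rs : List (Row 0)) → (∀ B → All (Sat B Vector.[]) rs) → All (SatDir Vector.[]) rs
  noVariables-direction [] _ = []
  noVariables-direction (r ∷ rs) sat =
    bounded⇒weight≡0 (weight r) (offset r) (λ B → All.head (sat B)) ∷ noVariables-direction rs (λ B → All.tail (sat B))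

  integerDirection : ∀ n (rs : List (Row n)) → (∀ B → ∃ λ v → All (Sat B v) rs) → ∃ λ d → All (SatDir d) rs
  integerDirection zero rs sat = Vector.[] , noVariables-direction rs (λ B → proj₂ (sat B))
  integerDirection (suc n) rs sat with integerDirection n (eliminate rs)
    (λ B → Vector.tail (proj₁ (sat B)) , eliminate-sat B (proj₁ (sat B)) rs (proj₂ (sat B)))
  ... | d' , sat' = eliminate-lift rs d' sat'

module Topology {c : Level} (𝒵 : ZGroup c) where
  open ZGroup 𝒵
  open ZG 𝒵 hiding (_≤_)
  open ZGroupProperties 𝒵
  open Q

  <Q-respʳ-≈Q : ∀ {l p q} → l <Q p → p ≈Q q → l <Q q
  <Q-respʳ-≈Q {l} {p} {q} l<p p≈q = ×ₙ-cancelʳ-< (den-1 p) (subst₂ _<_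
    (×ₙ-comm (den q) (den p) (num l))
    (trans (×ₙ-comm (den q) (den l) (num p)) (trans (cong (den l ×ₙ_) p≈q) (×ₙ-comm (den l) (den p) (num q))))
    (×ₙ-monoʳ-< (den-1 q) l<p))

  <Q-respˡ-≈Q : ∀ {u p q} → p <Q u → p ≈Q q → q <Q u
  <Q-respˡ-≈Q {u} {p} {q} p<u p≈q = ×ₙ-cancelʳ-< (den-1 p) (subst₂ _<_
    (trans (×ₙ-comm (den q) (den u) (num p)) (trans (cong (den u ×ₙ_) p≈q) (×ₙ-comm (den u) (den p) (num q))))
    (×ₙ-comm (den q) (den p) (num u))
    (×ₙ-monoʳ-< (den-1 q) p<u))

  ≈Ω-refl : ∀ {x} → x ≈Ω x
  ≈Ω-refl {fin q} = fin≈ refl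
  ≈Ω-refl {∞} = ∞≈

  ≈Ω-sym : ∀ {x y} → x ≈Ω y → y ≈Ω x
  ≈Ω-sym (fin≈ e) = fin≈ (sym e)
  ≈Ω-sym ∞≈ = ∞≈

  ∈B-resp-≈Ω : ∀ {x y U} → x ≈Ω y → x ∈B U → y ∈B U
  ∈B-resp-≈Ω {fin p} {fin q} {⟨ l , nothing ⟩} (fin≈ e) (above-fin l<p , below-none) =
    above-fin (<Q-respʳ-≈Q {l} {p} {q} l<p e) , below-none
  ∈B-resp-≈Ω {fin p} {fin q} {⟨ l , just u ⟩} (fin≈ e) (above-fin l<p , below-fin p<u) =
    above-fin (<Q-respʳ-≈Q {l} {p} {q} l<p e) , below-fin (<Q-respˡ-≈Q {u} {p} {q} p<u e)
  ∈B-resp-≈Ω ∞≈ x∈U = x∈U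

  IsFin-resp-≈Ω : ∀ {x y : Ω} → x ≈Ω y → IsFin x → IsFin y
  IsFin-resp-≈Ω (fin≈ _) (isFin _) = isFin _

  HasSupp-resp-≈Ω : ∀ {m} {J : Subset m} {a b : Fin m → Ω} → (∀ i → a i ≈Ω b i) → HasSupp J a → HasSupp J b
  HasSupp-resp-≈Ω a≈b supp i =
    (λ i∈J → IsFin-resp-≈Ω (a≈b i) (proj₁ (supp i) i∈J)) ,
    (λ finite → proj₂ (supp i) (IsFin-resp-≈Ω (≈Ω-sym (a≈b i)) finite))

  cl-resp-≈Ω : ∀ {m} {S : SetΩ m} {a b} → (∀ i → a i ≈Ω b i) → cl S b → cl S a
  cl-resp-≈Ω a≈b b∈S̄ U a∈U = b∈S̄ U (λ i → ∈B-resp-≈Ω (a≈b i) (a∈U i))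

  cl-mono : ∀ {m} {S T : SetΩ m} → S ⊆ₛ T → cl S ⊆ₛ cl T
  cl-mono S⊆T a a∈S̄ U a∈U with a∈S̄ U a∈U
  ... | s , s∈S , s∈U = s , S⊆T s s∈S , s∈U

  cl-idem : ∀ {m} {S : SetΩ m} → cl (cl S) ⊆ₛ cl S
  cl-idem a a∈S̄̄ U a∈U with a∈S̄̄ U a∈U
  ... | s , s∈S̄ , s∈U = s∈S̄ U s∈U

  ∞∈B⇒unbounded : ∀ {U w} → ∞ ∈B U → Above (BOpen.lo U) w → w ∈B U
  ∞∈B⇒unbounded {⟨ l , nothing ⟩} _ above = above , below-none

  -- ](n − 1)/d, (n + 1)/d[ contains ιQ y only if d·y = n, by discreteness (see squeeze).
  nbhd : Carrier → Ω → BOpen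
  nbhd B (fin q) = ⟨ (num q + - 1#) /1+ den-1 q , just ((num q + 1#) /1+ den-1 q) ⟩
  nbhd B ∞ = ⟨ ιQ B , nothing ⟩

  ∈nbhd : ∀ B w → w ∈B nbhd B w
  ∈nbhd B (fin q) = above-fin (×ₙ-monoʳ-< (den-1 q) n-1<n) , below-fin (×ₙ-monoʳ-< (den-1 q) (x<x+1 (num q)))
    where
    n-1<n : num q + - 1# < num q
    n-1<n = subst (num q + - 1# <_) (neg-+-cancelʳ (num q) 1#) (x<x+1 (num q + - 1#))
  ∈nbhd B ∞ = above-∞ , below-none

  ∈nbhd-fin⇒IsFin : ∀ B {q w} → w ∈B nbhd B (fin q) → IsFin w
  ∈nbhd-fin⇒IsFin B {w = fin _} _ = isFin _

  data Near (B : Carrier) : Ω → Γ → Set c where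
    near-fin : ∀ {q y} → den q ×ₙ y ≡ num q → Near B (fin q) (fin y)
    near-∞ : Near B ∞ ∞
    near-large : ∀ {y} → B < y → Near B ∞ (fin y)

  squeeze : ∀ {n w} → n + - 1# < w → w < n + 1# → w ≡ n
  squeeze {n} {w} n-1<w w<n+1 = ≤-antisym
    (+-cancelʳ-≤ 1# (<⇒+1≤ w<n+1))
    (subst (_≤ w) (neg-+-cancelʳ n 1#) (<⇒+1≤ n-1<w))

  ∈nbhd⇒Near : ∀ B w g → ιΓ g ∈B nbhd B w → Near B w g
  ∈nbhd⇒Near B (fin q) (fin y) (above-fin l<y , below-fin y<u) = near-fin
    (squeeze (subst (_< den q ×ₙ y) (+-identityʳ _) l<y) (subst (den q ×ₙ y <_) (+-identityʳ _) y<u))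
  ∈nbhd⇒Near B ∞ ∞ _ = near-∞
  ∈nbhd⇒Near B ∞ (fin y) (above-fin B<y , _) = near-large (subst₂ _<_ (+-identityʳ B) (+-identityʳ y) B<y)

  cl-approx : ∀ {m} {A : SetΓ m} {a : Fin m → Ω} → cl (liftΓ A) a → ∀ B →
    ∃ λ x → A x × (∀ i → Near B (a i) (x i))
  cl-approx {a = a} a∈Ā B with a∈Ā (λ i → nbhd B (a i)) (λ i → ∈nbhd B (a i))
  ... | s , (x , x∈A , s≈x) , s∈U = x , x∈A , λ i → ∈nbhd⇒Near B (a i) (x i) (∈B-resp-≈Ω (s≈x i) (s∈U i))

  <Q-ιQ-+ : ∀ l z e → (abs (Q.num l) + 1#) + abs z ≤ e → l <Q ιQ (z + e)
  <Q-ιQ-+ l z e bound = subst (_< Q.den l ×ₙ (z + e)) (sym (+-identityʳ n))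
    (<-≤-trans n<w (x≤n×x (Q.den l) (≤-trans (abs-nonneg n) (inj₁ (<-≤-trans (x<x+1 (abs n)) n+1≤w)))))
    where
    n = Q.num l
    n+1≤w : abs n + 1# ≤ z + e
    n+1≤w = ≤-trans (x≤x+y (abs n + 1#) (0≤x+abs z))
      (≤-trans (inj₂ (x∙yz≈y∙xz _ z (abs z))) (+-monoˡ-≤ z bound))
    n<w : n < z + e
    n<w = ≤-<-trans (x≤abs n) (<-≤-trans (x<x+1 (abs n)) n+1≤w)

module Faces {c : Level} (𝒵 : ZGroup c) {m : ℕ} (P : ZG.BasicPresburger 𝒵 m) where
  open ZGroup 𝒵
  open ZG 𝒵 hiding (_≤_)
  open ZGroupProperties 𝒵
  open FourierMotzkin 𝒵
  open Topology 𝒵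
  open BasicPresburger P

  A : SetΓ m
  A = ⟦ P ⟧

  π-∈ : ∀ {J : Subset m} {x i} → i ∈ J → π J x i ≡ x i
  π-∈ {J} {x} {i} i∈J with lookup J i | []=⇒lookup i∈J
  ... | true | _ = refl

  π-∉ : ∀ {J : Subset m} {x i} → i ∉ J → π J x i ≡ ∞
  π-∉ {J} {x} {i} i∉J with lookup J i in eq
  ... | true = ⊥-elim (i∉J (lookup⇒[]= i J eq))
  ... | false = refl

  ¬IsFin⇒∞ : ∀ {X : Set c} (g : Ext X) → ¬ IsFin g → g ≡ ∞
  ¬IsFin⇒∞ (fin z) ¬fin = ⊥-elim (¬fin (isFin z))
  ¬IsFin⇒∞ ∞ _ = refl

  -- ∞ is read as 0; harmless, since term ignores infinite coordinates.
  val : Γ → Carrier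
  val (fin z) = z
  val ∞ = 0#

  lin-val : ∀ (cf : Fin m → ℤ) x → lin cf x ≡ cf ⊛ (λ i → val (x i))
  lin-val cf x = sumFin-cong λ i → term-val (cf i) (x i)
    where
    term-val : ∀ k g → term k g ≡ k ×ℤ val g
    term-val k (fin z) = refl
    term-val k ∞ = sym (×ℤ-zeroʳ k)

  -- An integer recession direction of A that moves exactly the coordinates in I ∖ K.
  record Direction (K : Subset m) (d : Fin m → ℤ) : Set c where
    field
      fixed : ∀ i → i ∈ K → d i ≡ pos 0
      outside : ∀ i → i ∉ I → d i ≡ pos 0
      escaping : ∀ i → i ∈ I → i ∉ K → pos 1 ℤ.≤ d i
      ineqs-nonneg : All (λ φ → pos 0 ℤ.≤ Ineq.coeff φ · d) ineqs

  Near-fin-val : ∀ {B B' q g g'} → Near B (fin q) g → Near B' (fin q) g' → val g ≡ val g'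
  Near-fin-val {q = q} (near-fin e) (near-fin e') = ×ₙ-cancelʳ-≡ (Q.den-1 q) (trans e (sym e'))

  Near-∞-val : ∀ {B g} → Near B ∞ g → IsFin g → B < val g
  Near-∞-val (near-large B<y) _ = B<y

  Near-IsFin : ∀ {B q g} → Near B (fin q) g → IsFin g
  Near-IsFin (near-fin _) = isFin _

  module DirectionSystem (K : Subset m) (x₀ : Fin m → Γ) where

    coordinateRows : Fin m → List (Row m)
    coordinateRows i with i ∈? K ⊎-dec ¬? (i ∈? I)
    ... | yes _ = row (unitVec i (pos 1)) 0 (val (x₀ i)) ∷ row (unitVec i -[1+ 0 ]) 0 (- val (x₀ i)) ∷ []
    ... | no _ = row (unitVec i (pos 1)) 1 0# ∷ []

    rows : List (Row m)
    rows = concat (tabulate coordinateRows) ++ map (λ φ → row (Ineq.coeff φ) 0 (Ineq.bound φ)) ineqs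

    free : ∀ {i} → ¬ (i ∈ K ⊎ i ∉ I) → i ∉ K × i ∈ I
    free {i} ¬fixed = (λ i∈K → ¬fixed (inj₁ i∈K)) , decidable-stable (i ∈? I) (λ i∉I → ¬fixed (inj₂ i∉I))

    rows-sat : ∀ B x → A x → (∀ i → i ∈ K ⊎ i ∉ I → val (x i) ≡ val (x₀ i)) →
      (∀ i → i ∉ K → i ∈ I → B < val (x i)) → All (Sat B (λ i → val (x i))) rows
    rows-sat B x x∈A fixedEq freeLarge = All.++⁺ (All.concat⁺ (All.tabulate⁺ coordinate))
      (All.map⁺ (All.map (λ {φ} h → subst₂ _≤_ (sym (+-identityˡ _)) (lin-val (Ineq.coeff φ) x) h) (proj₁ (proj₂ x∈A))))
      where
      v = λ i → val (x i)
      e⁺ : ∀ i → unitVec i (pos 1) ⊛ v ≡ v i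
      e⁺ i = trans (unitVec-⊛ i (pos 1) v) (+-identityʳ _)
      e⁻ : ∀ i → unitVec i -[1+ 0 ] ⊛ v ≡ - v i
      e⁻ i = trans (unitVec-⊛ i -[1+ 0 ] v) (cong -_ (+-identityʳ _))
      coordinate : ∀ i → All (Sat B v) (coordinateRows i)
      coordinate i with i ∈? K ⊎-dec ¬? (i ∈? I)
      ... | yes fixed = inj₂ (trans (+-identityˡ _) (sym (trans (e⁺ i) (fixedEq i fixed))))
                      ∷ inj₂ (trans (+-identityˡ _) (sym (trans (e⁻ i) (cong -_ (fixedEq i fixed)))))
                      ∷ []
      ... | no ¬fixed = inj₁ (subst₂ _<_ (sym (trans (+-identityʳ _) (+-identityʳ B))) (sym (e⁺ i))
                                          (freeLarge i (proj₁ (free ¬fixed)) (proj₂ (free ¬fixed))))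
                      ∷ []

    zero-from-both-signs : ∀ x → pos 0 ℤ.≤ pos 1 ℤ.* x → pos 0 ℤ.≤ -[1+ 0 ] ℤ.* x → x ≡ pos 0
    zero-from-both-signs (pos zero) _ _ = refl
    zero-from-both-signs (pos (suc n)) _ ()
    zero-from-both-signs -[1+ n ] () _

    rows-direction : ∀ d → All (SatDir d) rows → Direction K d
    rows-direction d sat = record
      { fixed = λ i i∈K → fixedZero i (inj₁ i∈K)
      ; outside = λ i i∉I → fixedZero i (inj₂ i∉I)
      ; escaping = freeOne
      ; ineqs-nonneg = All.map⁻ (All.++⁻ʳ _ sat)
      }
      where
      coordinate : ∀ i → All (SatDir d) (coordinateRows i)
      coordinate = All.tabulate⁻ (All.concat⁻ (All.++⁻ˡ _ sat))
      fixedZero : ∀ i → i ∈ K ⊎ i ∉ I → d i ≡ pos 0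
      fixedZero i fixed with i ∈? K ⊎-dec ¬? (i ∈? I) | coordinate i
      ... | yes _ | lower ∷ upper ∷ [] = zero-from-both-signs (d i)
            (subst (pos 0 ℤ.≤_) (unitVec-· i (pos 1) d) lower) (subst (pos 0 ℤ.≤_) (unitVec-· i -[1+ 0 ] d) upper)
      ... | no ¬fixed | _ = ⊥-elim (¬fixed fixed)
      freeOne : ∀ i → i ∈ I → i ∉ K → pos 1 ℤ.≤ d i
      freeOne i i∈I i∉K with i ∈? K ⊎-dec ¬? (i ∈? I) | coordinate i
      ... | yes (inj₁ i∈K) | _ = ⊥-elim (i∉K i∈K)
      ... | yes (inj₂ i∉I) | _ = ⊥-elim (i∉I i∈I)
      ... | no _ | lower ∷ [] = subst (pos 1 ℤ.≤_) (trans (unitVec-· i (pos 1) d) (ℤP.*-identityˡ (d i))) lower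

  face-direction : ∀ {K a} → F K (liftΓ A) a → ∃ (Direction K)
  face-direction {K} {a} (a∈Ā , supp) with cl-approx a∈Ā 0#
  ... | x₀ , x₀∈A , near₀ with integerDirection m rows solution
    where
    open DirectionSystem K x₀
    solution : ∀ B → ∃ λ v → All (Sat B v) rows
    solution B with cl-approx a∈Ā B
    ... | x , x∈A , near = _ , rows-sat B x x∈A fixedEq freeLarge
      where
      fixedEq : ∀ i → i ∈ K ⊎ i ∉ I → val (x i) ≡ val (x₀ i)
      fixedEq i (inj₁ i∈K) with a i | proj₁ (supp i) i∈K | near i | near₀ i
      ... | fin q | _ | nearᵢ | near₀ᵢ = Near-fin-val nearᵢ near₀ᵢ
      fixedEq i (inj₂ i∉I) = cong val (trans (¬IsFin⇒∞ (x i) (λ finite → i∉I (proj₂ (proj₁ x∈A i) finite)))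
                                             (sym (¬IsFin⇒∞ (x₀ i) (λ finite → i∉I (proj₂ (proj₁ x₀∈A i) finite)))))
      freeLarge : ∀ i → i ∉ K → i ∈ I → B < val (x i)
      freeLarge i i∉K i∈I with a i | ¬IsFin⇒∞ (a i) (λ finite → i∉K (proj₂ (supp i) finite)) | near i
      ... | ∞ | refl | nearᵢ = Near-∞-val nearᵢ (proj₁ (proj₁ x∈A i) i∈I)
  ... | d , sat = d , DirectionSystem.rows-direction K x₀ d sat

  shiftΓ : Carrier → ℤ → Γ → Γ
  shiftΓ t k (fin z) = fin (z + k ×ℤ t)
  shiftΓ t k ∞ = ∞

  lin-shift : ∀ cf t (d : Fin m → ℤ) x → (∀ i → x i ≡ ∞ → d i ≡ pos 0) →
    lin cf (λ i → shiftΓ t (d i) (x i)) ≡ lin cf x + (cf · d) ×ℤ t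
  lin-shift cf t d x d∞ = begin
    lin cf (λ i → shiftΓ t (d i) (x i))                    ≡⟨ sumFin-cong (λ i → term-shift (cf i) (d i) (x i) (d∞ i)) ⟩
    sumFin (λ i → term (cf i) (x i) + (cf i ℤ.* d i) ×ℤ t) ≡⟨ sumFin-distrib-+ _ (λ i → (cf i ℤ.* d i) ×ℤ t) ⟩
    lin cf x + sumFin (λ i → (cf i ℤ.* d i) ×ℤ t)          ≡⟨ cong (lin cf x +_) (sumFin-×ℤ (λ i → cf i ℤ.* d i) t) ⟩
    lin cf x + (cf · d) ×ℤ t                               ∎
    where
    open ≡-Reasoning
    term-shift : ∀ k dᵢ g → (g ≡ ∞ → dᵢ ≡ pos 0) → term k (shiftΓ t dᵢ g) ≡ term k g + (k ℤ.* dᵢ) ×ℤ t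
    term-shift k dᵢ (fin z) _ = trans (×ℤ-distrib-+ k z (dᵢ ×ℤ t)) (cong (k ×ℤ z +_) (sym (×ℤ-assoc k dᵢ t)))
    term-shift k dᵢ ∞ d≡0 rewrite d≡0 refl | ℤP.*-zeroʳ k = sym (+-identityʳ 0#)

  modulus : CongCond m → ℕ
  modulus ψ = suc (CongCond.modulus-1 ψ)

  residue : CongCond m → Carrier
  residue ψ = toℕ (CongCond.residue ψ) ×ₙ 1#

  -- Shifting by multiples of period keeps every congruence condition.
  period : ℕ
  period = product (map modulus congs)

  modulus∣product : ∀ cs → All (λ ψ → modulus ψ ∣ product (map modulus cs)) cs
  modulus∣product [] = []
  modulus∣product (ψ ∷ cs) = m∣m*n _ ∷ All.map (λ h → ∣-trans h (n∣m*n (modulus ψ))) (modulus∣product cs)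

  product-nonZero : ∀ cs → ℕ.NonZero (product (map modulus cs))
  product-nonZero [] = _
  product-nonZero (ψ ∷ cs) = ℕP.m*n≢0 (modulus ψ) _ {{_}} {{product-nonZero cs}}

  instance
    period-nonZero : ℕ.NonZero period
    period-nonZero = product-nonZero congs

  ≡[]-+-period : ∀ {x r} n g s → n ∣ period → x ≡[ n ] r → (x + g ×ℤ (period ×ₙ s)) ≡[ n ] r
  ≡[]-+-period {x} {r} n g s (divides q period≡qn) x≡r =
    subst (λ w → (x + w) ≡[ n ] r) (sym gt≡nw) (≡[]-+-multiple n (g ×ℤ (q ×ₙ s)) x≡r)
    where
    gt≡nw : g ×ℤ (period ×ₙ s) ≡ n ×ₙ (g ×ℤ (q ×ₙ s))
    gt≡nw = begin
      g ×ℤ (period ×ₙ s)        ≡⟨ cong (λ M → g ×ℤ (M ×ₙ s)) (trans period≡qn (ℕP.*-comm q n)) ⟩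
      g ×ℤ ((n ℕ.* q) ×ₙ s)     ≡⟨ cong (g ×ℤ_) (×ₙ-assoc n q s) ⟩
      g ×ℤ (n ×ₙ (q ×ₙ s))      ≡⟨ ×ℤ-×ₙ-comm g n (q ×ₙ s) ⟩
      n ×ₙ (g ×ℤ (q ×ₙ s))      ∎
      where open ≡-Reasoning

  shiftΓ-IsFin⁺ : ∀ t k {g} → IsFin g → IsFin (shiftΓ t k g)
  shiftΓ-IsFin⁺ t k (isFin z) = isFin _

  shiftΓ-IsFin⁻ : ∀ t k g → IsFin (shiftΓ t k g) → IsFin g
  shiftΓ-IsFin⁻ t k (fin z) _ = isFin z

  ∞-notFin : ¬ IsFin {Carrier} ∞
  ∞-notFin ()

  module Shift {K : Subset m} {d : Fin m → ℤ} (dir : Direction K d) {x : Fin m → Γ} (x∈A : A x) where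
    open Direction dir

    shifted : Carrier → Fin m → Γ
    shifted s i = shiftΓ (period ×ₙ s) (d i) (x i)

    d≡0-at-∞ : ∀ i → x i ≡ ∞ → d i ≡ pos 0
    d≡0-at-∞ i x≡∞ = outside i (λ i∈I → ∞-notFin (subst IsFin x≡∞ (proj₁ (proj₁ x∈A i) i∈I)))

    shifted-∈A : ∀ s → 0# ≤ s → A (shifted s)
    shifted-∈A s 0≤s = support , All.zipWith (λ {φ} → ineq {φ}) (proj₁ (proj₂ x∈A) , ineqs-nonneg) ,
                                 All.zipWith (λ {ψ} → congruence {ψ}) (proj₂ (proj₂ x∈A) , modulus∣product congs)
      where
      t = period ×ₙ s
      support : HasSupp I (shifted s)
      support i = (λ i∈I → shiftΓ-IsFin⁺ t (d i) (proj₁ (proj₁ x∈A i) i∈I)) ,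
                  (λ finite → proj₂ (proj₁ x∈A i) (shiftΓ-IsFin⁻ t (d i) (x i) finite))
      ineq : ∀ {φ} → Ineq.bound φ ≤ lin (Ineq.coeff φ) x × pos 0 ℤ.≤ Ineq.coeff φ · d →
             Ineq.bound φ ≤ lin (Ineq.coeff φ) (shifted s)
      ineq {φ} (bound≤ , 0≤φd) = ≤-trans bound≤ (subst (lin (Ineq.coeff φ) x ≤_)
        (sym (lin-shift (Ineq.coeff φ) t d x d≡0-at-∞)) (x≤x+y _ (×ℤ-nonneg _ 0≤φd (×ₙ-nonneg period 0≤s))))
      congruence : ∀ {ψ} → lin (CongCond.coeff ψ) x ≡[ modulus ψ ] residue ψ × modulus ψ ∣ period →
                   lin (CongCond.coeff ψ) (shifted s) ≡[ modulus ψ ] residue ψ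
      congruence {ψ} (x≡r , n∣period) =
        subst (_≡[ modulus ψ ] residue ψ) (sym (lin-shift (CongCond.coeff ψ) t d x d≡0-at-∞))
        (≡[]-+-period (modulus ψ) (CongCond.coeff ψ · d) s n∣period x≡r)

    shifted-fixes : ∀ s i → i ∈ K → shifted s i ≡ x i
    shifted-fixes s i i∈K rewrite fixed i i∈K = shift0 (x i)
      where
      shift0 : ∀ g → shiftΓ (period ×ₙ s) (pos 0) g ≡ g
      shift0 (fin z) = cong fin (+-identityʳ z)
      shift0 ∞ = refl

    margin : (Fin m → Q) → Carrier
    margin l = sumFin (λ i → (abs (Q.num (l i)) + 1#) + abs (val (x i)))

    margin-term-nonneg : ∀ (l : Fin m → Q) i → 0# ≤ (abs (Q.num (l i)) + 1#) + abs (val (x i))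
    margin-term-nonneg l i = +-nonneg (+-nonneg (abs-nonneg _) 0≤1) (abs-nonneg _)

    margin-nonneg : ∀ (l : Fin m → Q) → 0# ≤ margin l
    margin-nonneg l = sumFin-nonneg (margin-term-nonneg l)

    shifted-escapes : ∀ (l : Fin m → Q) i → i ∉ K → Above (l i) (ιΓ (shifted (margin l) i))
    shifted-escapes l i i∉K with x i in x≡
    ... | ∞ = above-∞
    ... | fin z with d i | escaping i (proj₂ (proj₁ x∈A i) (subst IsFin (sym x≡) (isFin z))) i∉K
    ...   | pos zero | ℤ.+≤+ ()
    ...   | pos (suc k) | _ = above-fin (<Q-ιQ-+ (l i) z _ (≤-trans termᵢ≤
            (≤-trans (x≤n×x period (margin-nonneg l)) (x≤n×x (suc k) (×ₙ-nonneg period (margin-nonneg l))))))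
      where
      termᵢ≤ : (abs (Q.num (l i)) + 1#) + abs z ≤ margin l
      termᵢ≤ = subst (λ g → (abs (Q.num (l i)) + 1#) + abs (val g) ≤ margin l) x≡ (≤-sumFin _ (margin-term-nonneg l) i)

  Above-π : ∀ {l} J (y : Fin m → Γ) i → Above l (ιΓ (y i)) → Above l (ιΓ (π J y i))
  Above-π J y i above with i ∈? J
  ... | yes i∈J = subst (λ g → Above _ (ιΓ g)) (sym (π-∈ i∈J)) above
  ... | no i∉J = subst (λ g → Above _ (ιΓ g)) (sym (π-∉ i∉J)) above-∞

  -- Far enough along a direction fixing K, the point π_J y lies in any neighbourhood of π_K x.
  π-∈cl-πset : ∀ {K J d x} → Direction K d → A x → K ⊆ J → cl (πset J A) (λ i → ιΓ (π K x i))
  π-∈cl-πset {K} {J} {d} {x} dir x∈A K⊆J U πx∈U =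
    (λ i → ιΓ (π J y i)) , (y , shifted-∈A s (margin-nonneg l) , λ i → ≈Ω-refl) , y∈U
    where
    open Shift dir x∈A
    l = λ i → BOpen.lo (U i)
    s = margin l
    y = shifted s
    y∈U : ∀ i → ιΓ (π J y i) ∈B U i
    y∈U i with i ∈? K
    ... | yes i∈K = subst (λ g → ιΓ g ∈B U i)
          (trans (π-∈ i∈K) (trans (sym (shifted-fixes s i i∈K)) (sym (π-∈ (K⊆J i∈K))))) (πx∈U i)
    ... | no i∉K = ∞∈B⇒unbounded (subst (λ g → ιΓ g ∈B U i) (π-∉ i∉K) (πx∈U i))
          (Above-π J y i (shifted-escapes l i i∉K))

  face⊆I : ∀ {K a} → F K (liftΓ A) a → K ⊆ I
  face⊆I {K} {a} (a∈Ā , supp) {i} i∈K with cl-approx a∈Ā 0#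
  ... | x , x∈A , near with a i | proj₁ (supp i) i∈K | near i
  ... | fin q | _ | nearᵢ = proj₂ (proj₁ x∈A i) (Near-IsFin nearᵢ)

  face⊆πset : ∀ {K} → F K (liftΓ A) ⊆ₛ πset K A
  face⊆πset {K} a (a∈Ā , supp) with cl-approx a∈Ā 0#
  ... | x , x∈A , near = x , x∈A , a≈πx
    where
    a≈πx : ∀ i → a i ≈Ω ιΓ (π K x i)
    a≈πx i with i ∈? K
    ... | yes i∈K = subst (λ g → a i ≈Ω ιΓ g) (sym (π-∈ i∈K)) (exact (a i) (x i) (proj₁ (supp i) i∈K) (near i))
      where
      exact : ∀ w g → IsFin w → Near 0# w g → w ≈Ω ιΓ g
      exact (fin q) (fin y) _ (near-fin e) = fin≈ (trans (+-identityʳ _) (sym e))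
    ... | no i∉K = subst₂ _≈Ω_ (sym (¬IsFin⇒∞ (a i) (λ finite → i∉K (proj₂ (supp i) finite))))
                               (cong ιΓ (sym (π-∉ i∉K))) ∞≈

  πset-⊤ : πset ⊤ A ⊆ₛ liftΓ A
  πset-⊤ a (x , x∈A , a≈) = x , x∈A , λ i → subst (λ g → a i ≈Ω ιΓ g) (π-∈ ∈⊤) (a≈ i)

  π-HasSupp : ∀ {K x} → K ⊆ I → A x → HasSupp K (λ i → ιΓ (π K x i))
  π-HasSupp {K} {x} K⊆I x∈A i = finite , supported
    where
    finite : i ∈ K → IsFin (ιΓ (π K x i))
    finite i∈K rewrite π-∈ {K} {x} i∈K with x i | proj₁ (proj₁ x∈A i) (K⊆I i∈K)
    ... | fin z | _ = isFin _
    supported : IsFin (ιΓ (π K x i)) → i ∈ K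
    supported finite with i ∈? K
    ... | yes i∈K = i∈K
    ... | no i∉K rewrite π-∉ {K} {x} i∉K with finite
    ... | ()

  πset⊆face : ∀ {K d} → Direction K d → K ⊆ I → πset K A ⊆ₛ F K (liftΓ A)
  πset⊆face dir K⊆I a (x , x∈A , a≈) =
    cl-resp-≈Ω a≈ (cl-mono πset-⊤ _ (π-∈cl-πset dir x∈A (λ _ → ∈⊤))) ,
    HasSupp-resp-≈Ω (λ i → ≈Ω-sym (a≈ i)) (π-HasSupp K⊆I x∈A)

  Direction-nonneg : ∀ {K d} → Direction K d → ∀ i → pos 0 ℤ.≤ d i
  Direction-nonneg {K} {d} dir i with i ∈? K | i ∈? I
  ... | yes i∈K | _ = ℤP.≤-reflexive (sym (Direction.fixed dir i i∈K))
  ... | no i∉K | yes i∈I = ℤP.≤-trans (ℤ.+≤+ ℕ.z≤n) (Direction.escaping dir i i∈I i∉K)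
  ... | no _ | no i∉I = ℤP.≤-reflexive (sym (Direction.outside dir i i∉I))

  Direction-∩ : ∀ {H J d d'} → Direction H d → Direction J d' → Direction (H ∩ J) (λ i → d i ℤ.+ d' i)
  Direction-∩ {H} {J} {d} {d'} dir dir' = record
    { fixed = λ i i∈H∩J → let i∈H , i∈J = x∈p∩q⁻ H J i∈H∩J in cong₂ ℤ._+_ (D.fixed i i∈H) (D'.fixed i i∈J)
    ; outside = λ i i∉I → cong₂ ℤ._+_ (D.outside i i∉I) (D'.outside i i∉I)
    ; escaping = escaping
    ; ineqs-nonneg = All.zipWith (λ {φ} (0≤φd , 0≤φd') → subst (pos 0 ℤ.≤_) (sym (·-distribʳ-+ (Ineq.coeff φ) d d'))
                                   (ℤP.+-mono-≤ 0≤φd 0≤φd')) (D.ineqs-nonneg , D'.ineqs-nonneg)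
    }
    where
    module D = Direction dir
    module D' = Direction dir'
    escaping : ∀ i → i ∈ I → i ∉ H ∩ J → pos 1 ℤ.≤ d i ℤ.+ d' i
    escaping i i∈I i∉H∩J with i ∈? H | i ∈? J
    ... | yes i∈H | yes i∈J = ⊥-elim (i∉H∩J (x∈p∩q⁺ (i∈H , i∈J)))
    ... | no i∉H | _ = ℤP.+-mono-≤ (D.escaping i i∈I i∉H) (Direction-nonneg dir' i)
    ... | yes _ | no i∉J = ℤP.+-mono-≤ (Direction-nonneg dir i) (D'.escaping i i∈I i∉J)

  NonemptyFace : Subset m → Set c
  NonemptyFace K = Nonempty (F K (liftΓ A))

  face≐πset : ∀ {K} → NonemptyFace K → F K (liftΓ A) ≐ πset K A
  face≐πset (_ , a∈F) b = face⊆πset b , πset⊆face (proj₂ (face-direction a∈F)) (face⊆I a∈F) b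

  face⊆cl-face : ∀ {J H} → NonemptyFace J → H ⊆ J → F H (liftΓ A) ⊆ₛ cl (F J (liftΓ A))
  face⊆cl-face (_ , b∈F) H⊆J a a∈F with face⊆πset a a∈F
  ... | x , x∈A , a≈ = cl-resp-≈Ω a≈
    (cl-mono (πset⊆face (proj₂ (face-direction b∈F)) (face⊆I b∈F)) _
             (π-∈cl-πset (proj₂ (face-direction a∈F)) x∈A H⊆J))

  cl-face⇒⊆ : ∀ {J H} → NonemptyFace H → F H (liftΓ A) ⊆ₛ cl (F J (liftΓ A)) → H ⊆ J
  cl-face⇒⊆ (a , a∈F@(_ , supp)) F_H⊆cl {i} i∈H with F_H⊆cl a a∈F (λ j → nbhd 0# (a j)) (λ j → ∈nbhd 0# (a j))
  ... | s , (_ , suppₛ) , s∈U with a i | proj₁ (supp i) i∈H | s∈U i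
  ... | fin q | _ | sᵢ∈U = proj₂ (suppₛ i) (∈nbhd-fin⇒IsFin 0# sᵢ∈U)

  face-of-face : ∀ {J H} → NonemptyFace J → H ⊆ J → F H (liftΓ A) ≐ F H (F J (liftΓ A))
  face-of-face neJ H⊆J a = (λ a∈F → face⊆cl-face neJ H⊆J a a∈F , proj₂ a∈F)
                         , (λ (a∈cl , supp) → cl-idem a (cl-mono (λ _ → proj₁) a a∈cl) , supp)

  face-∩ : ∀ {J H} → NonemptyFace J → NonemptyFace H → NonemptyFace (H ∩ J)
  face-∩ {J} {H} (_ , b∈F) (a , a∈F) with face⊆πset a a∈F
  ... | x , x∈A , _ = _ , πset⊆face (Direction-∩ (proj₂ (face-direction a∈F)) (proj₂ (face-direction b∈F)))
                                    (λ i∈H∩J → face⊆I a∈F (p∩q⊆p H J i∈H∩J)) _ (x , x∈A , λ i → ≈Ω-refl)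

proposition3p3 : ∀ {c} (𝒵 : ZGroup c) {m : ℕ} (P : ZG.BasicPresburger 𝒵 m) →
    let open ZG 𝒵 in
    (∀ (J H : Subset m) →
      Nonempty (F J (liftΓ ⟦ P ⟧)) → Nonempty (F H (liftΓ ⟦ P ⟧)) →
      (F J (liftΓ ⟦ P ⟧) ≐ πset J ⟦ P ⟧)
      × (H ⊆ J → F H (liftΓ ⟦ P ⟧) ≐ F H (F J (liftΓ ⟦ P ⟧)))
      × ((F H (liftΓ ⟦ P ⟧) ⊆ₛ cl (F J (liftΓ ⟦ P ⟧))) ⇔ (H ⊆ J))
      × Nonempty (F (H ∩ J) (liftΓ ⟦ P ⟧)))
    × ((∀ (J H : Subset m) →
          Nonempty (F J (liftΓ ⟦ P ⟧)) → Nonempty (F H (liftΓ ⟦ P ⟧)) →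
          (F J (liftΓ ⟦ P ⟧) ⊆ₛ cl (F H (liftΓ ⟦ P ⟧))) ⊎ (F H (liftΓ ⟦ P ⟧) ⊆ₛ cl (F J (liftΓ ⟦ P ⟧))))
       ⇔
       (∀ (J H : Subset m) →
          Nonempty (F J (liftΓ ⟦ P ⟧)) → Nonempty (F H (liftΓ ⟦ P ⟧)) →
          (J ⊆ H) ⊎ (H ⊆ J)))
proposition3p3 𝒵 P =
  (λ J H neJ neH → face≐πset neJ , face-of-face neJ , mk⇔ (cl-face⇒⊆ neH) (face⊆cl-face neJ) , face-∩ neJ neH) ,
  mk⇔ (λ ordered J H neJ neH → Sum.map (cl-face⇒⊆ neJ) (cl-face⇒⊆ neH) (ordered J H neJ neH))
      (λ ordered J H neJ neH → Sum.map (face⊆cl-face neH) (face⊆cl-face neJ) (ordered J H neJ neH))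
  where open Faces 𝒵 P
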